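{- Let $P\in\mathsf{stLSQ}(n)^{\bullet k}$ satisfy $\mathsf{sched}(P)=1^n$. Then for any $Q\in\mathcal{CC}(P)$, one has $\mathsf{sched}(Q)=1^n$ if and only if the $0$-th diagonal of $Q$ (the squares with two vertices on $y=x$) contains exactly one undecorated vertical step of $Q$.
   Context: A square path of size $n$ is a lattice path from $(0,0)$ to $(n,n)$ of unit north (vertical) and east steps ending with an east step. The $j$-th diagonal is the set of unit squares with two vertices on $y=x+j$; each vertical step is identified with the unit square of which it is the left edge. Area word: $a_i=j$ if the $i$-th vertical step starts on $y=x+j$; shift $s=-\min_i a_i$. A labeling is a word $w_1\cdots w_n$ of positive integers ($w_i$ in the square of the $i$-th vertical step) strictly increasing upward within columns; standard if the labels are $1,\dots,n$. The $i$-th vertical step is a contractible valley if ($i>1$, $a_{i-1}>a_i$) or ($i>1$, $a_{i-1}=a_i$, $w_{i-1}<w_i$) or ($i=1$, $a_1\le -1$). $\mathsf{LSQ}(n)^{\bullet k}$: labeled square paths with a set of exactly $k$ contractible valleys marked as decorated; $\mathsf{stLSQ}(n)^{\bullet k}$: the standardly labeled ones. Diagonal word and schedule word: for $P\in\mathsf{stLSQ}(n)^{\bullet k}$ with shift $s$, $\rho_i$ is the list of labels in the $(i-s)$-th diagonal in decreasing order, each marked decorated if its step is; $\mathsf{dw}(P)=\rho_0\rho_1\cdots$. For a decorated permutation $\sigma$ with maximal decreasing runs $\rho_0\cdots\rho_l$, $\tilde\rho_i$ the undecorated letters of $\rho_i$ ($\rho_{l+1}=\emptyset$), and $s\in\{0,\dots,l\}$,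 the schedule number of $c\in\rho_i$ is $\#\{d\in\tilde\rho_i:d>c\}+1$ if $i=s$ and $c$ undecorated; $\#\{d\in\tilde\rho_i:d>c\}+\#\{d\in\tilde\rho_{i-1}:d<c\}$ if $i>s$ and $c$ undecorated; $\#\{d\in\tilde\rho_i:d<c\}+\#\{d\in\tilde\rho_{i+1}:d>c\}$ if $i<s$ or $c$ decorated (all $0$ if $s>l$). $\mathsf{sched}(P)$ is the word of schedule numbers of $(\mathsf{dw}(P),s)$. Cutting cycle: for $P\in\mathsf{LSQ}(n)^{\bullet k}$ and $i\in[n]$, write $P=P_1P_2$ with $P_1$ ending at the $i$-th east step and set $\psi_i(P)=P_2P_1$ (steps keep labels and decorations); $\mathcal{CC}(P)=\{\psi_i(P):i\in[n]\}\cap\mathsf{LSQ}(n)^{\bullet k}$. -}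

module Defs where

open import Data.Nat as ℕ using (ℕ; zero; suc; _<ᵇ_; _≤_; _<_)
open import Data.Integer as ℤ using (ℤ; +_; -_; _⊓_)
open import Data.Bool using (Bool; true; false; if_then_else_; not; _∧_; _∨_)
open import Data.List using (List; []; _∷_; _++_; map; filterᵇ; length; foldr; replicate; upTo; [_])
open import Data.List.Relation.Unary.All using (All)
open import Data.List.Relation.Binary.Permutation.Propositional using (_↭_)
open import Data.Product using (_×_; _,_; Σ; ∃; proj₁; proj₂)
open import Data.Sum using (_⊎_)
open import Data.Unit using (⊤)
open import Relation.Nullary using (does)
open import Relation.Binary.PropositionalEquality using (_≡_)

data Step : Set where
  east  : Step
  north : (label : ℕ) → (decorated : Bool) → Step

Path : Set
Path = List Step

-- A vertical step seen with its area value a_i (its start lies on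
-- y = x + a_i), its label w_i and its decoration flag.
record VStep : Set where
  constructor vstep
  field
    area  : ℤ
    label : ℕ
    dec   : Bool
open VStep public

-- vertical steps in order (bottom to top), d = y - x of current point
vertsFrom : ℤ → Path → List VStep
vertsFrom d []               = []
vertsFrom d (east ∷ p)       = vertsFrom (d ℤ.- + 1) p
vertsFrom d (north w b ∷ p)  = vstep d w b ∷ vertsFrom (d ℤ.+ + 1) p

vsteps : Path → List VStep
vsteps = vertsFrom (+ 0)

isEast : Step → Bool
isEast east        = true
isEast (north _ _) = false

numEast : Path → ℕ
numEast p = length (filterᵇ isEast p)

numNorth : Path → ℕ
numNorth p = length (vsteps p)

labels : Path → List ℕ
labels p = map label (vsteps p)

IsSquarePath : ℕ → Path → Set
IsSquarePath n p = numNorth p ≡ n × numEast p ≡ n × Σ Path (λ q → p ≡ q ++ [ east ])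

ColumnIncreasing : Path → Set
ColumnIncreasing []                                  = ⊤
ColumnIncreasing (east ∷ p)                          = ColumnIncreasing p
ColumnIncreasing (north w b ∷ [])                    = ⊤
ColumnIncreasing (north w b ∷ east ∷ p)              = ColumnIncreasing (east ∷ p)
ColumnIncreasing (north w b ∷ north w' b' ∷ p)       = w < w' × ColumnIncreasing (north w' b' ∷ p)

ContractibleFirst : VStep → Set
ContractibleFirst v = area v ℤ.≤ - (+ 1)

ContractibleNext : VStep → VStep → Set
ContractibleNext u v = (area v ℤ.< area u) ⊎ (area u ≡ area v × label u < label v)

DecoratedOKFrom : VStep → List VStep → Set
DecoratedOKFrom u []       = ⊤
DecoratedOKFrom u (v ∷ vs) = (dec v ≡ true → ContractibleNext u v) × DecoratedOKFrom v vs

DecoratedOK : List VStep → Set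
DecoratedOK []       = ⊤
DecoratedOK (v ∷ vs) = (dec v ≡ true → ContractibleFirst v) × DecoratedOKFrom v vs

numDecorated : Path → ℕ
numDecorated p = length (filterᵇ (λ v → dec v) (vsteps p))

LSQ : ℕ → ℕ → Path → Set
LSQ n k p = IsSquarePath n p
          × All (λ w → 1 ≤ w) (labels p)
          × ColumnIncreasing p
          × DecoratedOK (vsteps p)
          × numDecorated p ≡ k

StLSQ : ℕ → ℕ → Path → Set
StLSQ n k p = LSQ n k p × labels p ↭ map suc (upTo n)

minZ : List ℤ → ℤ
minZ []       = + 0
minZ (x ∷ xs) = foldr _⊓_ x xs

shift : Path → ℤ
shift p = - minZ (map area (vsteps p))

-- diagonal word: vertical steps ordered by diagonal (increasing),
-- and inside a diagonal by decreasing label; this is ρ₀ρ₁⋯ where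
-- ρ_i lists the labels on the (i-s)-th diagonal in decreasing order.

before : VStep → VStep → Bool
before u v = does (area u ℤ.<? area v)
           ∨ (does (area u ℤ.≟ area v) ∧ (label v <ᵇ label u))

insertDW : VStep → List VStep → List VStep
insertDW v []       = [ v ]
insertDW v (u ∷ us) = if before v u then v ∷ u ∷ us else u ∷ insertDW v us

-- decorated letters: (value , decorated?)
Letter : Set
Letter = ℕ × Bool

dw : Path → List Letter
dw p = map (λ v → label v , dec v) (foldr insertDW [] (vsteps p))

addToRuns : Letter → List (List Letter) → List (List Letter)
addToRuns x []               = [ x ∷ [] ]
addToRuns x ([] ∷ rs)        = (x ∷ []) ∷ [] ∷ rs
addToRuns x ((y ∷ r) ∷ rs)   =
  if proj₁ y <ᵇ proj₁ x then (x ∷ y ∷ r) ∷ rs else (x ∷ []) ∷ (y ∷ r) ∷ rs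

runs : List Letter → List (List Letter)
runs = foldr addToRuns []

tildeRun : List Letter → List ℕ
tildeRun r = map proj₁ (filterᵇ (λ x → not (proj₂ x)) r)

countGt : ℕ → List ℕ → ℕ
countGt c ds = length (filterᵇ (λ d → c <ᵇ d) ds)

countLt : ℕ → List ℕ → ℕ
countLt c ds = length (filterᵇ (λ d → d <ᵇ c) ds)

-- schedule number of letter (c , decorated?) in run ρ_i, with
-- prev = ρ̃_{i-1}, cur = ρ̃_i, next = ρ̃_{i+1}
schedNum : ℤ → ℕ → List ℕ → List ℕ → List ℕ → Letter → ℕ
schedNum s i prev cur next (c , true)  = countLt c cur ℕ.+ countGt c next
schedNum s i prev cur next (c , false) =
  if does ((+ i) ℤ.≟ s) then countGt c cur ℕ.+ 1
  else if does (s ℤ.<? (+ i)) then countGt c cur ℕ.+ countLt c prev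
  else countLt c cur ℕ.+ countGt c next

nextTilde : List (List Letter) → List ℕ
nextTilde []      = []          -- ρ_{l+1} = ∅
nextTilde (r ∷ _) = tildeRun r

schedRuns : ℤ → ℕ → List ℕ → List (List Letter) → List ℕ
schedRuns s i prev []       = []
schedRuns s i prev (r ∷ rs) =
  map (schedNum s i prev (tildeRun r) (nextTilde rs)) r
  ++ schedRuns s (suc i) (tildeRun r) rs

-- schedule word of (σ , s); all zeros if s > l (i.e. s ≥ number of runs)
schedWord : List Letter → ℤ → List ℕ
schedWord σ s =
  if does ((+ length (runs σ)) ℤ.≤? s) then replicate (length σ) 0
  else schedRuns s 0 [] (runs σ)

sched : Path → List ℕ
sched p = schedWord (dw p) (shift p)

splitAfterEast : ℕ → Path → Path × Path
splitAfterEast zero p                  = [] , p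
splitAfterEast (suc i) []              = [] , []
splitAfterEast (suc i) (east ∷ p)      =
  (east ∷ proj₁ (splitAfterEast i p)) , proj₂ (splitAfterEast i p)
splitAfterEast (suc i) (north w b ∷ p) =
  (north w b ∷ proj₁ (splitAfterEast (suc i) p)) , proj₂ (splitAfterEast (suc i) p)

ψ : ℕ → Path → Path
ψ i p = proj₂ (splitAfterEast i p) ++ proj₁ (splitAfterEast i p)

InCC : ℕ → ℕ → Path → Path → Set
InCC n k p q = Σ ℕ (λ i → 1 ≤ i × i ≤ n × q ≡ ψ i p) × LSQ n k q

numUndecZeroDiag : Path → ℕ
numUndecZeroDiag q =
  length (filterᵇ (λ v → does (area v ℤ.≟ + 0) ∧ not (dec v)) (vsteps q))

-- The diagonal word is invariant under the cutting cycle: cutting P = P₁P₂ at a point of height h and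
-- gluing P₂P₁ lowers every vertical step by h, which keeps the order by diagonal and, inside a
-- diagonal, by decreasing label. Column-increasing labels make this word change diagonal only by going
-- one diagonal up to a larger label, so its maximal decreasing runs are exactly the occupied diagonals,
-- and the shift numbers them so that run number s is diagonal 0. The claim thus concerns one
-- decorated word σ with two shifts s and s′.
--
-- If all schedule numbers of (σ, s) are 1, then every ρ̃ᵢ has at most two letters, ρ̃ₛ exactly one,
-- and the ρ̃ᵢ from the shift on are nonempty. For two consecutive such runs a₁ > a₂ and b₁ > b₂, the
-- condition imposed below the shift on the first and the one imposed above the shift on the second
-- both say b₂ ≤ a₂ < b₁ ≤ a₁. Hence the shift can be moved to any s′ whose ρ̃ₛ′ is a single letter,
-- and conversely at a shift with schedule numbers 1 the run ρ̃ₛ′ must be a single letter.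

module Submission where

open import Defs
open import Data.Bool using (Bool; true; false; T; T?; not; _∧_)
open import Data.Bool.Properties using (T-≡)
open import Data.Empty using (⊥)
open import Data.Integer as ℤ using (ℤ; +_; -_)
import Data.Integer.Properties as ℤₚ
open import Data.Integer.Tactic.RingSolver using (solve-∀)
open import Algebra.Properties.AbelianGroup ℤₚ.+-0-abelianGroup using (∙-cancelˡ; ∙-cancelʳ)
open import Data.List using (List; []; _∷_; [_]; _++_; concat; foldr; filterᵇ; length; map; replicate; upTo)
open import Data.List.Properties using (length-++; length-map; ∷-injective; map-∘; map-++; ++-identityʳ)
open import Data.List.Membership.Propositional using (_∈_; find)
open import Data.List.Membership.Propositional.Properties using (foldr-selective; ∈-map⁺; ∈-map⁻)
open import Data.List.Relation.Binary.Permutation.Propositional as Perm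
  using (_↭_; ↭-refl; ↭-sym; ↭-trans; ↭-prep; ↭-swap)
import Data.List.Relation.Binary.Permutation.Propositional.Properties as ↭
open import Data.List.Relation.Unary.All using (All; []; _∷_)
import Data.List.Relation.Unary.All as All
import Data.List.Relation.Unary.All.Properties as All
open import Data.List.Relation.Unary.AllPairs using (AllPairs; []; _∷_)
import Data.List.Relation.Unary.AllPairs as AllPairs
import Data.List.Relation.Unary.AllPairs.Properties as AllPairs
open import Data.List.Relation.Unary.Any as Any using (Any; here; there)
open import Data.List.Relation.Unary.Linked using (Linked; []; [-]; _∷_)
open import Data.List.Relation.Unary.Unique.Propositional.Properties
  using (upTo⁺) renaming (map⁺ to Unique-map⁺)
open import Data.Nat as ℕ using (ℕ; zero; suc; z≤n; s≤s; _+_; _≤_; _<_; _>_; _<ᵇ_; _<?_)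
open import Data.Nat.Properties
open import Data.Product using (_×_; _,_; proj₁; proj₂; Σ-syntax)
open import Data.Product.Function.NonDependent.Propositional using (_×-⇔_)
open import Data.Sum using (_⊎_; inj₁; inj₂)
open import Data.Unit using (tt)
open import Function using (_∘_; _on_)
open import Function.Bundles using (_⇔_; mk⇔; Equivalence)
import Function.Properties.Equivalence as ⇔
open import Relation.Binary.Definitions using (tri<; tri≈; tri>)
open import Relation.Binary.PropositionalEquality hiding ([_])
open import Relation.Nullary using (¬_; yes; no; does; contradiction)

<⇒<ᵇ≡true : ∀ {m n} → m < n → (m <ᵇ n) ≡ true
<⇒<ᵇ≡true = Equivalence.to T-≡ ∘ <⇒<ᵇ

<ᵇ≡true⇒< : ∀ {m n} → (m <ᵇ n) ≡ true → m < n
<ᵇ≡true⇒< {m} {n} = <ᵇ⇒< m n ∘ Equivalence.from T-≡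

<ᵇ≡false⇒≮ : ∀ {m n} → (m <ᵇ n) ≡ false → ¬ m < n
<ᵇ≡false⇒≮ m<ᵇn≡false m<n = contradiction (trans (sym (<⇒<ᵇ≡true m<n)) m<ᵇn≡false) λ ()

≮⇒<ᵇ≡false : ∀ {m n} → ¬ m < n → (m <ᵇ n) ≡ false
≮⇒<ᵇ≡false {m} {n} m≮n with m <ᵇ n in eq
... | false = refl
... | true  = contradiction (<ᵇ≡true⇒< eq) m≮n

module _ {A : Set} (p : A → Bool) where

  length-filterᵇ-accept : ∀ {x} xs → p x ≡ true →
                          length (filterᵇ p (x ∷ xs)) ≡ suc (length (filterᵇ p xs))
  length-filterᵇ-accept xs px rewrite px = refl

  length-filterᵇ-reject : ∀ {x} xs → p x ≡ false →
                          length (filterᵇ p (x ∷ xs)) ≡ length (filterᵇ p xs)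
  length-filterᵇ-reject xs px rewrite px = refl

≡⇔≡ : ∀ {A : Set} {x x′ y y′ : A} → x ≡ x′ → y ≡ y′ → (x ≡ y) ⇔ (x′ ≡ y′)
≡⇔≡ refl refl = ⇔.refl

+-≡1-cong : ∀ {m n} k → m ≡ n → (m + k ≡ 1) ⇔ (n + k ≡ 1)
+-≡1-cong _ refl = ⇔.refl

suc≡1⇔≡0 : ∀ {n} → suc n ≡ 1 ⇔ n ≡ 0
suc≡1⇔≡0 = mk⇔ suc-injective (cong suc)

module _ {A : Set} {P : A → Set} where

  All-singleton : ∀ {x} → All P [ x ] ⇔ P x
  All-singleton = mk⇔ (λ { (px ∷ []) → px }) (_∷ [])

  All-pair : ∀ {x y} → All P (x ∷ y ∷ []) ⇔ (P x × P y)
  All-pair = mk⇔ (λ { (px ∷ py ∷ []) → px , py }) (λ (px , py) → px ∷ py ∷ [])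

nonempty⇒1≤length : ∀ {A : Set} {xs : List A} → xs ≢ [] → 1 ≤ length xs
nonempty⇒1≤length {xs = []}    xs≢[] = contradiction refl xs≢[]
nonempty⇒1≤length {xs = _ ∷ _} _     = s≤s z≤n

length≡1⇒nonempty : ∀ {A : Set} {xs : List A} → length xs ≡ 1 → xs ≢ []
length≡1⇒nonempty len≡1 refl = 0≢1+n len≡1

≡replicate⇔All≡ : ∀ {A : Set} {x : A} xs → xs ≡ replicate (length xs) x ⇔ All (_≡ x) xs
≡replicate⇔All≡ []       = mk⇔ (λ _ → []) (λ _ → refl)
≡replicate⇔All≡ (y ∷ xs) = mk⇔
  (λ eq → let (y≡x , rest) = ∷-injective eq in y≡x ∷ Equivalence.to (≡replicate⇔All≡ xs) rest)
  (λ { (y≡x ∷ rest) → cong₂ _∷_ y≡x (Equivalence.from (≡replicate⇔All≡ xs) rest) })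

AllPairs-resp-↭ : ∀ {A : Set} {R : A → A → Set} → (∀ {x y} → R x y → R y x) →
                  ∀ {xs ys} → xs ↭ ys → AllPairs R xs → AllPairs R ys
AllPairs-resp-↭ R-sym Perm.refl         rxs        = rxs
AllPairs-resp-↭ R-sym (Perm.prep x p)   (rx ∷ rxs) = ↭.All-resp-↭ p rx ∷ AllPairs-resp-↭ R-sym p rxs
AllPairs-resp-↭ R-sym (Perm.swap x y p) ((rxy ∷ rx) ∷ ry ∷ rxs) =
  (R-sym rxy ∷ ↭.All-resp-↭ p ry) ∷ ↭.All-resp-↭ p rx ∷ AllPairs-resp-↭ R-sym p rxs
AllPairs-resp-↭ R-sym (Perm.trans p q)  rxs        = AllPairs-resp-↭ R-sym q (AllPairs-resp-↭ R-sym p rxs)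

module _ {c x : ℕ} (xs : List ℕ) where

  countGt-∷-< : c < x → countGt c (x ∷ xs) ≡ suc (countGt c xs)
  countGt-∷-< = length-filterᵇ-accept (c <ᵇ_) {x} xs ∘ <⇒<ᵇ≡true

  countGt-∷-≮ : ¬ c < x → countGt c (x ∷ xs) ≡ countGt c xs
  countGt-∷-≮ = length-filterᵇ-reject (c <ᵇ_) {x} xs ∘ ≮⇒<ᵇ≡false

  countLt-∷-< : x < c → countLt c (x ∷ xs) ≡ suc (countLt c xs)
  countLt-∷-< = length-filterᵇ-accept (_<ᵇ c) {x} xs ∘ <⇒<ᵇ≡true

  countLt-∷-≮ : ¬ x < c → countLt c (x ∷ xs) ≡ countLt c xs
  countLt-∷-≮ = length-filterᵇ-reject (_<ᵇ c) {x} xs ∘ ≮⇒<ᵇ≡false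

countGt-all< : ∀ {c} xs → All (_< c) xs → countGt c xs ≡ 0
countGt-all< []       []           = refl
countGt-all< (x ∷ xs) (x<c ∷ xs<c) = trans (countGt-∷-≮ xs (<⇒≯ x<c)) (countGt-all< xs xs<c)

countGt-self : ∀ c xs → countGt c (c ∷ xs) ≡ countGt c xs
countGt-self c xs = countGt-∷-≮ {c} {c} xs (<-irrefl refl)

countLt-self : ∀ c xs → countLt c (c ∷ xs) ≡ countLt c xs
countLt-self c xs = countLt-∷-≮ {c} {c} xs (<-irrefl refl)

countGt-single≡0 : ∀ {c} b → countGt c [ b ] ≡ 0 ⇔ b ≤ c
countGt-single≡0 {c} b with c <? b
... | yes c<b = mk⇔ (λ e → contradiction (trans (sym (countGt-∷-< [] c<b)) e) 1+n≢0)
                   (λ b≤c → contradiction c<b (≤⇒≯ b≤c))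
... | no  c≮b = mk⇔ (λ _ → ≮⇒≥ c≮b) (λ _ → countGt-∷-≮ [] c≮b)

countGt-single≡1 : ∀ {c} b → countGt c [ b ] ≡ 1 ⇔ c < b
countGt-single≡1 {c} b with c <? b
... | yes c<b = mk⇔ (λ _ → c<b) (λ _ → countGt-∷-< [] c<b)
... | no  c≮b = mk⇔ (λ e → contradiction (trans (sym (countGt-∷-≮ [] c≮b)) e) 0≢1+n)
                   (λ c<b → contradiction c<b c≮b)

countLt-single≡0 : ∀ {c} a → countLt c [ a ] ≡ 0 ⇔ c ≤ a
countLt-single≡0 {c} a with a <? c
... | yes a<c = mk⇔ (λ e → contradiction (trans (sym (countLt-∷-< [] a<c)) e) 1+n≢0)
                   (λ c≤a → contradiction a<c (≤⇒≯ c≤a))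
... | no  a≮c = mk⇔ (λ _ → ≮⇒≥ a≮c) (λ _ → countLt-∷-≮ [] a≮c)

countLt-single≡1 : ∀ {c} a → countLt c [ a ] ≡ 1 ⇔ a < c
countLt-single≡1 {c} a with a <? c
... | yes a<c = mk⇔ (λ _ → a<c) (λ _ → countLt-∷-< [] a<c)
... | no  a≮c = mk⇔ (λ e → contradiction (trans (sym (countLt-∷-≮ [] a≮c)) e) 0≢1+n)
                   (λ a<c → contradiction a<c a≮c)

module _ {b₁ b₂ : ℕ} (b₂<b₁ : b₂ < b₁) where

  countGt-pair≡0 : ∀ {c} → countGt c (b₁ ∷ b₂ ∷ []) ≡ 0 ⇔ b₁ ≤ c
  countGt-pair≡0 {c} with c <? b₁
  ... | yes c<b₁ = mk⇔ (λ e → contradiction (trans (sym (countGt-∷-< [ b₂ ] c<b₁)) e) 1+n≢0)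
                       (λ b₁≤c → contradiction c<b₁ (≤⇒≯ b₁≤c))
  ... | no  c≮b₁ = mk⇔ (λ _ → ≮⇒≥ c≮b₁)
                       (λ b₁≤c → trans (countGt-∷-≮ [ b₂ ] c≮b₁)
                                       (Equivalence.from (countGt-single≡0 b₂) (<⇒≤ (<-≤-trans b₂<b₁ b₁≤c))))

  countGt-pair≡1 : ∀ {c} → countGt c (b₁ ∷ b₂ ∷ []) ≡ 1 ⇔ (b₂ ≤ c × c < b₁)
  countGt-pair≡1 {c} with c <? b₁
  ... | yes c<b₁ = mk⇔
    (λ e → Equivalence.to (countGt-single≡0 b₂) (suc-injective (trans (sym step) e)) , c<b₁)
    (λ (b₂≤c , _) → trans step (cong suc (Equivalence.from (countGt-single≡0 b₂) b₂≤c)))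
    where
    step : countGt c (b₁ ∷ b₂ ∷ []) ≡ suc (countGt c [ b₂ ])
    step = countGt-∷-< [ b₂ ] c<b₁
  ... | no  c≮b₁ = mk⇔
    (λ e → contradiction (trans (sym step) e) 0≢1+n)
    (λ (_ , c<b₁) → contradiction c<b₁ c≮b₁)
    where
    step : countGt c (b₁ ∷ b₂ ∷ []) ≡ 0
    step = trans (countGt-∷-≮ [ b₂ ] c≮b₁)
                 (Equivalence.from (countGt-single≡0 b₂) (<⇒≤ (<-≤-trans b₂<b₁ (≮⇒≥ c≮b₁))))

module _ {a₁ a₂ : ℕ} (a₂<a₁ : a₂ < a₁) where

  countLt-pair≡0 : ∀ {c} → countLt c (a₁ ∷ a₂ ∷ []) ≡ 0 ⇔ c ≤ a₂
  countLt-pair≡0 {c} with a₁ <? c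
  ... | yes a₁<c = mk⇔ (λ e → contradiction (trans (sym (countLt-∷-< [ a₂ ] a₁<c)) e) 1+n≢0)
                       (λ c≤a₂ → contradiction (<-trans a₂<a₁ a₁<c) (≤⇒≯ c≤a₂))
  ... | no  a₁≮c = ⇔.trans (≡⇔≡ (countLt-∷-≮ [ a₂ ] a₁≮c) refl) (countLt-single≡0 a₂)

  countLt-pair≡1 : ∀ {c} → countLt c (a₁ ∷ a₂ ∷ []) ≡ 1 ⇔ (a₂ < c × c ≤ a₁)
  countLt-pair≡1 {c} with a₁ <? c
  ... | yes a₁<c = mk⇔
    (λ e → contradiction (trans (sym step) e) λ ())
    (λ (_ , c≤a₁) → contradiction a₁<c (≤⇒≯ c≤a₁))
    where
    step : countLt c (a₁ ∷ a₂ ∷ []) ≡ 2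
    step = trans (countLt-∷-< [ a₂ ] a₁<c) (cong suc (countLt-∷-< [] (<-trans a₂<a₁ a₁<c)))
  ... | no  a₁≮c = mk⇔ (λ e → Equivalence.to (countLt-single≡1 a₂) (trans (sym step) e) , ≮⇒≥ a₁≮c)
                       (λ (a₂<c , _) → trans step (Equivalence.from (countLt-single≡1 a₂) a₂<c))
    where
    step : countLt c (a₁ ∷ a₂ ∷ []) ≡ countLt c [ a₂ ]
    step = countLt-∷-≮ [ a₂ ] a₁≮c

Decreasing : List ℕ → Set
Decreasing = AllPairs _>_

-- Schedule number 1 for an undecorated letter c of a run ρᵢ with i < s, i = s and i > s
-- (cur = ρ̃ᵢ, prev = ρ̃ᵢ₋₁, next = ρ̃ᵢ₊₁); a decorated letter has schedule number 1 iff OneBelow.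
OneBelow : List ℕ → List ℕ → ℕ → Set
OneBelow cur next c = countLt c cur + countGt c next ≡ 1

OneAtShift : List ℕ → ℕ → Set
OneAtShift cur c = countGt c cur + 1 ≡ 1

OneAbove : List ℕ → List ℕ → ℕ → Set
OneAbove prev cur c = countGt c cur + countLt c prev ≡ 1

oneAtShift⇒length≤1 : ∀ U → Decreasing U → All (OneAtShift U) U → length U ≤ 1
oneAtShift⇒length≤1 []            _                  _             = z≤n
oneAtShift⇒length≤1 (_ ∷ [])      _                  _             = s≤s z≤n
oneAtShift⇒length≤1 (a₁ ∷ a₂ ∷ U) ((a₂<a₁ ∷ _) ∷ _) (_ ∷ one ∷ _) =
  contradiction (trans (sym (countGt-∷-< (a₂ ∷ U) a₂<a₁)) (+-cancelʳ-≡ 1 _ 0 one)) 1+n≢0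

oneBelow⇒length≤2 : ∀ U V → Decreasing U → All (OneBelow U V) U → length U ≤ 2
oneBelow⇒length≤2 []            _ _ _ = z≤n
oneBelow⇒length≤2 (_ ∷ [])      _ _ _ = s≤s z≤n
oneBelow⇒length≤2 (_ ∷ _ ∷ [])  _ _ _ = s≤s (s≤s z≤n)
oneBelow⇒length≤2 (a₁ ∷ a₂ ∷ a₃ ∷ U) V ((a₂<a₁ ∷ a₃<a₁ ∷ _) ∷ _) (one ∷ _) =
  contradiction (trans (sym (cong (_+ countGt a₁ V) two)) one) λ ()
  where
  two : countLt a₁ (a₁ ∷ a₂ ∷ a₃ ∷ U) ≡ suc (suc (countLt a₁ U))
  two = trans (countLt-self a₁ _) (trans (countLt-∷-< _ a₂<a₁) (cong suc (countLt-∷-< U a₃<a₁)))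

oneAbove⇒length≤2 : ∀ W U → Decreasing U → All (OneAbove W U) U → length U ≤ 2
oneAbove⇒length≤2 _ []            _ _ = z≤n
oneAbove⇒length≤2 _ (_ ∷ [])      _ _ = s≤s z≤n
oneAbove⇒length≤2 _ (_ ∷ _ ∷ [])  _ _ = s≤s (s≤s z≤n)
oneAbove⇒length≤2 W (a₁ ∷ a₂ ∷ a₃ ∷ U) ((_ ∷ a₃<a₁ ∷ _) ∷ (a₃<a₂ ∷ _) ∷ _) (_ ∷ _ ∷ one ∷ _) =
  contradiction (trans (sym (cong (_+ countLt a₃ W) two)) one) λ ()
  where
  two : countGt a₃ (a₁ ∷ a₂ ∷ a₃ ∷ U) ≡ suc (suc (countGt a₃ (a₃ ∷ U)))
  two = trans (countGt-∷-< _ a₃<a₁) (cong suc (countGt-∷-< _ a₃<a₂))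

oneAbove⇒prev≢[] : ∀ W U → Decreasing U → All (OneAbove W U) U → U ≢ [] → W ≢ []
oneAbove⇒prev≢[] W []      _          _         U≢[] = contradiction refl U≢[]
oneAbove⇒prev≢[] W (a ∷ U) (U<a ∷ _) (one ∷ _) _ refl =
  0≢1+n (trans (sym (cong (_+ 0) (trans (countGt-self a U) (countGt-all< U U<a)))) one)

oneBelow⇒next≢[] : ∀ U V → Decreasing U → All (OneBelow U V) U → U ≢ [] → V ≢ []
oneBelow⇒next≢[] []           _ _ _ U≢[] = contradiction refl U≢[]
oneBelow⇒next≢[] (a ∷ [])     V _ (one ∷ []) _ refl =
  0≢1+n (trans (sym (cong (_+ 0) (countLt-self a []))) one)
oneBelow⇒next≢[] (a₁ ∷ a₂ ∷ []) V ((a₂<a₁ ∷ []) ∷ _) (_ ∷ one ∷ []) _ refl =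
  0≢1+n (trans (sym (cong (_+ 0) (trans (countLt-∷-≮ _ (<⇒≯ a₂<a₁)) (countLt-self a₂ [])))) one)
oneBelow⇒next≢[] U@(_ ∷ _ ∷ _ ∷ _) V dec one _ with oneBelow⇒length≤2 U V dec one
... | s≤s (s≤s ())

DecoratedOne : List ℕ → List ℕ → List Letter → Set
DecoratedOne cur next r = All (λ (c , d) → d ≡ true → OneBelow cur next c) r

decoratedOne⇒next≢[] : ∀ r V → DecoratedOne (tildeRun r) V r → r ≢ [] → tildeRun r ≡ [] → V ≢ []
decoratedOne⇒next≢[] []               _ _       r≢[] _    _    = r≢[] refl
decoratedOne⇒next≢[] ((c , true) ∷ r) V (one ∷ _) _ ρ̃≡[] refl =
  0≢1+n (subst (λ ρ̃ → countLt c ρ̃ + 0 ≡ 1) ρ̃≡[] (one refl))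

data ShortDecreasing : List ℕ → Set where
  single : ∀ a → ShortDecreasing [ a ]
  pair   : ∀ {a₁ a₂} → a₂ < a₁ → ShortDecreasing (a₁ ∷ a₂ ∷ [])

shortDecreasing : ∀ L → Decreasing L → L ≢ [] → length L ≤ 2 → ShortDecreasing L
shortDecreasing []                _                 L≢[] _ = contradiction refl L≢[]
shortDecreasing (a ∷ [])          _                 _    _ = single a
shortDecreasing (a₁ ∷ a₂ ∷ [])    ((a₂<a₁ ∷ _) ∷ _) _    _ = pair a₂<a₁
shortDecreasing (_ ∷ _ ∷ _ ∷ _)   _                 _    (s≤s (s≤s ()))

-- The chain b₂ ≤ a₂ < b₁ ≤ a₁ for runs a₁ > a₂ and b₁ > b₂, where a run of length one
-- provides only a₂, resp. only b₁.
Interlaced : List ℕ → List ℕ → Set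
Interlaced (a ∷ [])       (b ∷ [])       = a < b
Interlaced (a ∷ [])       (b₁ ∷ b₂ ∷ []) = b₂ ≤ a × a < b₁
Interlaced (a₁ ∷ a₂ ∷ []) (b ∷ [])       = a₂ < b × b ≤ a₁
Interlaced (a₁ ∷ a₂ ∷ []) (b₁ ∷ b₂ ∷ []) = b₂ ≤ a₂ × a₂ < b₁ × b₁ ≤ a₁
Interlaced _              _              = ⊥

allOneBelow-single : ∀ a B → All (OneBelow [ a ] B) [ a ] ⇔ countGt a B ≡ 1
allOneBelow-single a B = ⇔.trans All-singleton (+-≡1-cong _ (countLt-self a []))

allOneBelow-pair : ∀ {a₁ a₂} B → a₂ < a₁ →
  All (OneBelow (a₁ ∷ a₂ ∷ []) B) (a₁ ∷ a₂ ∷ []) ⇔ (countGt a₁ B ≡ 0 × countGt a₂ B ≡ 1)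
allOneBelow-pair {a₁} {a₂} B a₂<a₁ =
  ⇔.trans All-pair (⇔.trans (+-≡1-cong _ top) suc≡1⇔≡0 ×-⇔ +-≡1-cong _ bottom)
  where
  top : countLt a₁ (a₁ ∷ a₂ ∷ []) ≡ 1
  top = trans (countLt-self a₁ _) (countLt-∷-< [] a₂<a₁)
  bottom : countLt a₂ (a₁ ∷ a₂ ∷ []) ≡ 0
  bottom = trans (countLt-∷-≮ _ (<⇒≯ a₂<a₁)) (countLt-self a₂ [])

allOneAbove-single : ∀ A b → All (OneAbove A [ b ]) [ b ] ⇔ countLt b A ≡ 1
allOneAbove-single A b = ⇔.trans All-singleton (+-≡1-cong _ (countGt-self b []))

allOneAbove-pair : ∀ A {b₁ b₂} → b₂ < b₁ →
  All (OneAbove A (b₁ ∷ b₂ ∷ [])) (b₁ ∷ b₂ ∷ []) ⇔ (countLt b₁ A ≡ 1 × countLt b₂ A ≡ 0)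
allOneAbove-pair A {b₁} {b₂} b₂<b₁ =
  ⇔.trans All-pair (+-≡1-cong _ top ×-⇔ ⇔.trans (+-≡1-cong _ bottom) suc≡1⇔≡0)
  where
  top : countGt b₁ (b₁ ∷ b₂ ∷ []) ≡ 0
  top = trans (countGt-self b₁ _) (countGt-∷-≮ [] (<⇒≯ b₂<b₁))
  bottom : countGt b₂ (b₁ ∷ b₂ ∷ []) ≡ 1
  bottom = trans (countGt-∷-< _ b₂<b₁) (cong suc (countGt-self b₂ []))

oneBelow⇔interlaced : ∀ {A B} → ShortDecreasing A → ShortDecreasing B →
                      All (OneBelow A B) A ⇔ Interlaced A B
oneBelow⇔interlaced (single a) (single b) = ⇔.trans (allOneBelow-single a [ b ]) (countGt-single≡1 b)
oneBelow⇔interlaced (single a) (pair {b₁} {b₂} b₂<b₁) =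
  ⇔.trans (allOneBelow-single a (b₁ ∷ b₂ ∷ [])) (countGt-pair≡1 b₂<b₁)
oneBelow⇔interlaced (pair a₂<a₁) (single b) =
  ⇔.trans (allOneBelow-pair [ b ] a₂<a₁) (⇔.trans (countGt-single≡0 b ×-⇔ countGt-single≡1 b)
    (mk⇔ (λ (x , y) → y , x) (λ (y , x) → x , y)))
oneBelow⇔interlaced (pair a₂<a₁) (pair {b₁} {b₂} b₂<b₁) =
  ⇔.trans (allOneBelow-pair (b₁ ∷ b₂ ∷ []) a₂<a₁) (⇔.trans (countGt-pair≡0 b₂<b₁ ×-⇔ countGt-pair≡1 b₂<b₁)
    (mk⇔ (λ (x , y , z) → y , z , x) (λ (y , z , x) → x , y , z)))

oneAbove⇔interlaced : ∀ {A B} → ShortDecreasing A → ShortDecreasing B →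
                      All (OneAbove A B) B ⇔ Interlaced A B
oneAbove⇔interlaced (single a) (single b) = ⇔.trans (allOneAbove-single [ a ] b) (countLt-single≡1 a)
oneAbove⇔interlaced (single a) (pair b₂<b₁) =
  ⇔.trans (allOneAbove-pair [ a ] b₂<b₁) (⇔.trans (countLt-single≡1 a ×-⇔ countLt-single≡0 a)
    (mk⇔ (λ (x , y) → y , x) (λ (y , x) → x , y)))
oneAbove⇔interlaced (pair {a₁} {a₂} a₂<a₁) (single b) =
  ⇔.trans (allOneAbove-single (a₁ ∷ a₂ ∷ []) b) (countLt-pair≡1 a₂<a₁)
oneAbove⇔interlaced (pair {a₁} {a₂} a₂<a₁) (pair b₂<b₁) =
  ⇔.trans (allOneAbove-pair (a₁ ∷ a₂ ∷ []) b₂<b₁) (⇔.trans (countLt-pair≡1 a₂<a₁ ×-⇔ countLt-pair≡0 a₂<a₁)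
    (mk⇔ (λ ((x , y) , z) → z , x , y) (λ (z , x , y) → (x , y) , z)))

oneBelow⇔oneAbove : ∀ {A B} → ShortDecreasing A → ShortDecreasing B →
                    All (OneBelow A B) A ⇔ All (OneAbove A B) B
oneBelow⇔oneAbove A B = ⇔.trans (oneBelow⇔interlaced A B) (⇔.sym (oneAbove⇔interlaced A B))

-- Schedule words and their shifts

DecreasingRun : List Letter → Set
DecreasingRun = AllPairs (_>_ on proj₁)

ProperRun : List Letter → Set
ProperRun r = r ≢ [] × DecreasingRun r

decreasing-tildeRun : ∀ {r} → DecreasingRun r → Decreasing (tildeRun r)
decreasing-tildeRun = AllPairs.map⁺ ∘ AllPairs.filter⁺ (T? ∘ not ∘ proj₂)

addToRuns-proper : ∀ x rs → All ProperRun rs → All ProperRun (addToRuns x rs)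
addToRuns-proper x []             []                           = ((λ ()) , [] ∷ []) ∷ []
addToRuns-proper x ([] ∷ rs)      ((r≢[] , _) ∷ _)             = contradiction refl r≢[]
addToRuns-proper x ((y ∷ r) ∷ rs) (ok@(_ , r<y ∷ dec) ∷ oks) with proj₁ y <ᵇ proj₁ x in y<ᵇx
... | true  = ((λ ()) , (y<x ∷ All.map (λ z<y → <-trans z<y y<x) r<y) ∷ r<y ∷ dec) ∷ oks
  where
  y<x : proj₁ y < proj₁ x
  y<x = <ᵇ≡true⇒< y<ᵇx
... | false = ((λ ()) , [] ∷ []) ∷ ok ∷ oks

runs-proper : ∀ σ → All ProperRun (runs σ)
runs-proper []      = []
runs-proper (x ∷ σ) = addToRuns-proper x (runs σ) (runs-proper σ)

concat-addToRuns : ∀ x rs → All ProperRun rs → concat (addToRuns x rs) ≡ x ∷ concat rs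
concat-addToRuns x []             _                = refl
concat-addToRuns x ([] ∷ rs)      ((r≢[] , _) ∷ _) = contradiction refl r≢[]
concat-addToRuns x ((y ∷ r) ∷ rs) _ with proj₁ y <ᵇ proj₁ x
... | true  = refl
... | false = refl

concat-runs : ∀ σ → concat (runs σ) ≡ σ
concat-runs []      = refl
concat-runs (x ∷ σ) = trans (concat-addToRuns x (runs σ) (runs-proper σ)) (cong (x ∷_) (concat-runs σ))

run : List (List Letter) → ℕ → List Letter
run []       _       = []
run (r ∷ rs) zero    = r
run (r ∷ rs) (suc i) = run rs i

run-beyond : ∀ rs i → length rs ≤ i → run rs i ≡ []
run-beyond []       _       _         = refl
run-beyond (r ∷ rs) (suc i) (s≤s len≤i) = run-beyond rs i len≤i

undec : List (List Letter) → ℕ → List ℕ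
undec rs i = tildeRun (run rs i)

-- ρ̃ᵢ₋₁, where the given list plays the role of ρ̃₋₁
undecBefore : List ℕ → List (List Letter) → ℕ → List ℕ
undecBefore prev rs zero    = prev
undecBefore prev rs (suc i) = undec rs i

WellFormedRuns : List (List Letter) → Set
WellFormedRuns rs = (∀ i → i < length rs → run rs i ≢ []) × (∀ i → Decreasing (undec rs i))

wellFormedRuns : ∀ σ → WellFormedRuns (runs σ)
wellFormedRuns σ = nonempty (runs σ) (runs-proper σ) , decreasing (runs σ) (runs-proper σ)
  where
  nonempty : ∀ rs → All ProperRun rs → ∀ i → i < length rs → run rs i ≢ []
  nonempty (r ∷ rs) ((r≢[] , _) ∷ _) zero    _           = r≢[]
  nonempty (r ∷ rs) (_ ∷ oks)        (suc i) (s≤s i<len) = nonempty rs oks i i<len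
  decreasing : ∀ rs → All ProperRun rs → ∀ i → Decreasing (undec rs i)
  decreasing []       []              _       = []
  decreasing (r ∷ rs) ((_ , dec) ∷ _) zero    = decreasing-tildeRun dec
  decreasing (r ∷ rs) (_ ∷ oks)       (suc i) = decreasing rs oks i

UndecOne : ℕ → ℕ → List ℕ → List ℕ → List ℕ → List ℕ → Set
UndecOne s i prev cur next W = (i < s → All (OneBelow cur next) W)
                             × (i ≡ s → All (OneAtShift cur) W)
                             × (s < i → All (OneAbove prev cur) W)

SchedOneAt : ℕ → List (List Letter) → ℕ → Set
SchedOneAt s rs i = DecoratedOne (undec rs i) (undec rs (suc i)) (run rs i)
                  × UndecOne s i (undecBefore [] rs i) (undec rs i) (undec rs (suc i)) (undec rs i)

SchedOne : ℕ → List (List Letter) → Set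
SchedOne s rs = ∀ i → i < length rs → SchedOneAt s rs i

module _ (t i : ℕ) (prev cur next : List ℕ) (c : ℕ) where

  schedNum-atShift : i ≡ t → schedNum (+ t) i prev cur next (c , false) ≡ countGt c cur + 1
  schedNum-atShift i≡t with i ℕ.≡ᵇ t in eq
  ... | true  = refl
  ... | false = contradiction (subst T eq (≡⇒≡ᵇ i t i≡t)) λ ()

  schedNum-above : t < i → schedNum (+ t) i prev cur next (c , false) ≡ countGt c cur + countLt c prev
  schedNum-above t<i with i ℕ.≡ᵇ t in eq | t <ᵇ i in lt
  ... | true  | _     = contradiction (≡ᵇ⇒≡ i t (subst T (sym eq) _)) (>⇒≢ t<i)
  ... | false | true  = refl
  ... | false | false = contradiction (subst T lt (<⇒<ᵇ t<i)) λ ()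

  schedNum-below : i < t → schedNum (+ t) i prev cur next (c , false) ≡ countLt c cur + countGt c next
  schedNum-below i<t with i ℕ.≡ᵇ t in eq | t <ᵇ i in lt
  ... | true  | _     = contradiction (≡ᵇ⇒≡ i t (subst T (sym eq) _)) (<⇒≢ i<t)
  ... | false | true  = contradiction (<ᵇ≡true⇒< lt) (<⇒≯ i<t)
  ... | false | false = refl

schedWord-inRange : ∀ σ t → t < length (runs σ) → schedWord σ (+ t) ≡ schedRuns (+ t) 0 [] (runs σ)
schedWord-inRange σ t t<l with length (runs σ) ℕ.≤ᵇ t in eq
... | true  = contradiction (≤ᵇ⇒≤ _ t (subst T (sym eq) _)) (<⇒≱ t<l)
... | false = refl

schedWord-outOfRange : ∀ σ t → length (runs σ) ≤ t → schedWord σ (+ t) ≡ replicate (length σ) 0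
schedWord-outOfRange σ t l≤t with length (runs σ) ℕ.≤ᵇ t in eq
... | true  = refl
... | false = contradiction (subst T eq (≤⇒≤ᵇ l≤t)) λ ()

SchedNumsOne : ℤ → ℕ → List ℕ → List ℕ → List ℕ → List Letter → Set
SchedNumsOne s i prev cur next r = All (λ x → schedNum s i prev cur next x ≡ 1) r

module _ (t i : ℕ) (prev cur next : List ℕ) where

  private
    Split : List Letter → Set
    Split r = DecoratedOne cur next r × UndecOne t i prev cur next (tildeRun r)

  schedNumsOne⇔ : ∀ r → SchedNumsOne (+ t) i prev cur next r ⇔ Split r
  schedNumsOne⇔ [] = mk⇔ (λ _ → [] , (λ _ → []) , (λ _ → []) , (λ _ → [])) (λ _ → [])
  schedNumsOne⇔ ((c , true) ∷ r) = mk⇔ to from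
    where
    to : SchedNumsOne (+ t) i prev cur next ((c , true) ∷ r) → Split ((c , true) ∷ r)
    to (one ∷ ones) = let (dec , undec) = Equivalence.to (schedNumsOne⇔ r) ones in ((λ _ → one) ∷ dec) , undec
    from : Split ((c , true) ∷ r) → SchedNumsOne (+ t) i prev cur next ((c , true) ∷ r)
    from (one ∷ dec , undec) = one refl ∷ Equivalence.from (schedNumsOne⇔ r) (dec , undec)
  schedNumsOne⇔ ((c , false) ∷ r) = mk⇔ to from
    where
    to : SchedNumsOne (+ t) i prev cur next ((c , false) ∷ r) → Split ((c , false) ∷ r)
    to (one ∷ ones) with Equivalence.to (schedNumsOne⇔ r) ones
    ... | dec , below , atShift , above =
      ((λ ()) ∷ dec) ,
      (λ i<t → trans (sym (schedNum-below t i prev cur next c i<t)) one ∷ below i<t) ,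
      (λ i≡t → trans (sym (schedNum-atShift t i prev cur next c i≡t)) one ∷ atShift i≡t) ,
      (λ t<i → trans (sym (schedNum-above t i prev cur next c t<i)) one ∷ above t<i)
    from : Split ((c , false) ∷ r) → SchedNumsOne (+ t) i prev cur next ((c , false) ∷ r)
    from (_ ∷ dec , below , atShift , above) =
      one ∷ Equivalence.from (schedNumsOne⇔ r)
              (dec , All.tail ∘ below , All.tail ∘ atShift , All.tail ∘ above)
      where
      one : schedNum (+ t) i prev cur next (c , false) ≡ 1
      one with <-cmp i t
      ... | tri< i<t _ _ = trans (schedNum-below t i prev cur next c i<t) (All.head (below i<t))
      ... | tri≈ _ i≡t _ = trans (schedNum-atShift t i prev cur next c i≡t) (All.head (atShift i≡t))
      ... | tri> _ _ t<i = trans (schedNum-above t i prev cur next c t<i) (All.head (above t<i))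

-- The runs rs numbered from j on, with ρ̃ⱼ₋₁ = prev.
RunsOne : ℤ → ℕ → List ℕ → List (List Letter) → Set
RunsOne s j prev rs = ∀ i → i < length rs →
  SchedNumsOne s (j + i) (undecBefore prev rs i) (undec rs i) (undec rs (suc i)) (run rs i)

SchedNumsOne-cong : ∀ {s j j′ prev prev′ cur next next′} r → j ≡ j′ → prev ≡ prev′ → next ≡ next′ →
  SchedNumsOne s j prev cur next r → SchedNumsOne s j′ prev′ cur next′ r
SchedNumsOne-cong _ refl refl refl ones = ones

nextTilde≡undec₀ : ∀ rs → nextTilde rs ≡ undec rs 0
nextTilde≡undec₀ []      = refl
nextTilde≡undec₀ (_ ∷ _) = refl

undecBefore-∷ : ∀ prev r rs i → undecBefore (tildeRun r) rs i ≡ undecBefore prev (r ∷ rs) (suc i)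
undecBefore-∷ _ _ _ zero    = refl
undecBefore-∷ _ _ _ (suc _) = refl

allOne-schedRuns⇔ : ∀ s j prev rs → All (_≡ 1) (schedRuns s j prev rs) ⇔ RunsOne s j prev rs
allOne-schedRuns⇔ s j prev []       = mk⇔ (λ _ _ ()) (λ _ → [])
allOne-schedRuns⇔ s j prev (r ∷ rs) = mk⇔ to from
  where
  IH : All (_≡ 1) (schedRuns s (suc j) (tildeRun r) rs) ⇔ RunsOne s (suc j) (tildeRun r) rs
  IH = allOne-schedRuns⇔ s (suc j) (tildeRun r) rs
  to : All (_≡ 1) (schedRuns s j prev (r ∷ rs)) → RunsOne s j prev (r ∷ rs)
  to ones with All.++⁻ (map _ r) ones
  ... | onesʳ , onesʳˢ = λ where
    zero    _           → SchedNumsOne-cong r (sym (+-identityʳ j)) refl (nextTilde≡undec₀ rs)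
                            (All.map⁻ onesʳ)
    (suc i) (s≤s i<len) → SchedNumsOne-cong (run rs i) (sym (+-suc j i)) (undecBefore-∷ prev r rs i) refl
                            (Equivalence.to IH onesʳˢ i i<len)
  from : RunsOne s j prev (r ∷ rs) → All (_≡ 1) (schedRuns s j prev (r ∷ rs))
  from ones = All.++⁺
    (All.map⁺ (SchedNumsOne-cong r (+-identityʳ j) refl (sym (nextTilde≡undec₀ rs)) (ones zero (s≤s z≤n))))
    (Equivalence.from IH λ i i<len →
      SchedNumsOne-cong (run rs i) (+-suc j i) (sym (undecBefore-∷ prev r rs i)) refl
                        (ones (suc i) (s≤s i<len)))

length-schedRuns : ∀ s j prev rs → length (schedRuns s j prev rs) ≡ length (concat rs)
length-schedRuns s j prev []       = refl
length-schedRuns s j prev (r ∷ rs) = begin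
  length (map _ r ++ schedRuns s (suc j) (tildeRun r) rs)  ≡⟨ length-++ (map _ r) ⟩
  length (map _ r) + length (schedRuns s (suc j) _ rs)
                         ≡⟨ cong₂ _+_ (length-map _ r) (length-schedRuns s (suc j) _ rs) ⟩
  length r + length (concat rs)                            ≡⟨ length-++ r ⟨
  length (concat (r ∷ rs))                                 ∎
  where open ≡-Reasoning

zeros≢ones : ∀ {σ : List Letter} → σ ≢ [] → replicate (length σ) 0 ≢ replicate (length σ) 1
zeros≢ones {[]}    σ≢[] = contradiction refl σ≢[]
zeros≢ones {_ ∷ _} _    ()

schedWord≡ones⇔ : ∀ σ t → σ ≢ [] →
  schedWord σ (+ t) ≡ replicate (length σ) 1 ⇔ (t < length (runs σ) × SchedOne t (runs σ))
schedWord≡ones⇔ σ t σ≢[] with t <? length (runs σ)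
... | no t≮l = mk⇔
  (λ ones → contradiction (trans (sym (schedWord-outOfRange σ t (≮⇒≥ t≮l))) ones) (zeros≢ones σ≢[]))
  (λ (t<l , _) → contradiction t<l t≮l)
... | yes t<l = ⇔.trans inRange (⇔.trans (≡replicate⇔All≡ w)
                  (⇔.trans (allOne-schedRuns⇔ (+ t) 0 [] rs) (mk⇔ perRun perRun⁻¹)))
  where
  rs : List (List Letter)
  rs = runs σ
  w : List ℕ
  w = schedRuns (+ t) 0 [] rs
  inRange : (schedWord σ (+ t) ≡ replicate (length σ) 1) ⇔ (w ≡ replicate (length w) 1)
  inRange rewrite schedWord-inRange σ t t<l | length-schedRuns (+ t) 0 [] rs | concat-runs σ =
    ⇔.refl
  perRun : RunsOne (+ t) 0 [] rs → t < length rs × SchedOne t rs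
  perRun ones = t<l , λ i i<l → Equivalence.to (schedNumsOne⇔ t i _ _ _ (run rs i)) (ones i i<l)
  perRun⁻¹ : t < length rs × SchedOne t rs → RunsOne (+ t) 0 [] rs
  perRun⁻¹ (_ , one) i i<l = Equivalence.from (schedNumsOne⇔ t i _ _ _ (run rs i)) (one i i<l)

singleton-oneAtShift : ∀ U → length U ≡ 1 → All (OneAtShift U) U
singleton-oneAtShift (a ∷ []) _ = cong (_+ 1) (countGt-self a []) ∷ []

module SchedOneProperties (rs : List (List Letter)) (wf : WellFormedRuns rs)
                          {s : ℕ} (one : SchedOne s rs) where

  private
    decreasing : ∀ i → Decreasing (undec rs i)
    decreasing = proj₂ wf

    decoratedOne : ∀ i → i < length rs → DecoratedOne (undec rs i) (undec rs (suc i)) (run rs i)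
    decoratedOne i i<l = proj₁ (one i i<l)

    below : ∀ i → i < length rs → i < s → All (OneBelow (undec rs i) (undec rs (suc i))) (undec rs i)
    below i i<l = proj₁ (proj₂ (one i i<l))

    atShift : ∀ i → i < length rs → i ≡ s → All (OneAtShift (undec rs i)) (undec rs i)
    atShift i i<l = proj₁ (proj₂ (proj₂ (one i i<l)))

    above : ∀ i → i < length rs → s < i → All (OneAbove (undecBefore [] rs i) (undec rs i)) (undec rs i)
    above i i<l = proj₂ (proj₂ (proj₂ (one i i<l)))

    onlyDecorated⇒next≢[] : ∀ i → i < length rs → undec rs i ≡ [] → undec rs (suc i) ≢ []
    onlyDecorated⇒next≢[] i i<l =
      decoratedOne⇒next≢[] (run rs i) _ (decoratedOne i i<l) (proj₁ wf i i<l)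

    last-undec≢[] : ∀ i → i < length rs → ¬ suc i < length rs → undec rs i ≢ []
    last-undec≢[] i i<l last ρ̃≡[] =
      onlyDecorated⇒next≢[] i i<l ρ̃≡[] (cong tildeRun (run-beyond rs (suc i) (≮⇒≥ last)))

  -- An empty ρ̃ₖ₊₁ makes run k + 1 purely decorated, which forces ρ̃ₖ₊₂ ≢ []: impossible for the last
  -- run, and otherwise contradicting OneAbove at run k + 2 or OneBelow at run k.
  undec-suc≢[] : ∀ k → suc k < length rs → undec rs (suc k) ≢ []
  undec-suc≢[] k k+1<l with suc (suc k) <? length rs
  ... | no  last      = last-undec≢[] (suc k) k+1<l last
  ... | yes k+2<l with s <? suc (suc k)
  ...   | yes s<k+2 = λ ρ̃≡[] → oneAbove⇒prev≢[] _ _ (decreasing _) (above _ k+2<l s<k+2)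
                                   (onlyDecorated⇒next≢[] (suc k) k+1<l ρ̃≡[]) ρ̃≡[]
  ...   | no  s≮k+2 with undec rs k in ρ̃ₖ
  ...     | []    = onlyDecorated⇒next≢[] k (<-trans (n<1+n k) k+1<l) ρ̃ₖ
  ...     | _ ∷ _ = oneBelow⇒next≢[] _ _ (decreasing k)
                      (below k (<-trans (n<1+n k) k+1<l) (<-trans (n<1+n k) (≮⇒≥ s≮k+2)))
                      (λ ρ̃≡[] → contradiction (trans (sym ρ̃ₖ) ρ̃≡[]) λ ())

  undec≢[] : ∀ i → i < length rs → s ≤ i → undec rs i ≢ []
  undec≢[] (suc k) i<l _   = undec-suc≢[] k i<l
  undec≢[] zero    0<l s≤0 with 1 <? length rs
  ... | yes 1<l = oneAbove⇒prev≢[] _ _ (decreasing 1) (above 1 1<l (s≤s s≤0)) (undec-suc≢[] 0 1<l)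
  ... | no  1≮l = last-undec≢[] 0 0<l 1≮l

  length-undec≤2 : ∀ i → i < length rs → length (undec rs i) ≤ 2
  length-undec≤2 i i<l with <-cmp i s
  ... | tri< i<s _ _ = oneBelow⇒length≤2 _ (undec rs (suc i)) (decreasing i) (below i i<l i<s)
  ... | tri≈ _ i≡s _ = ≤-trans (oneAtShift⇒length≤1 _ (decreasing i) (atShift i i<l i≡s)) (s≤s z≤n)
  ... | tri> _ _ s<i = oneAbove⇒length≤2 (undecBefore [] rs i) _ (decreasing i) (above i i<l s<i)

  length-undec-shift≡1 : s < length rs → length (undec rs s) ≡ 1
  length-undec-shift≡1 s<l = ≤-antisym (oneAtShift⇒length≤1 _ (decreasing s) (atShift s s<l refl))
                                       (nonempty⇒1≤length (undec≢[] s s<l ≤-refl))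

  private
    short : ∀ i → i < length rs → undec rs i ≢ [] → ShortDecreasing (undec rs i)
    short i i<l ρ̃≢[] = shortDecreasing _ (decreasing i) ρ̃≢[] (length-undec≤2 i i<l)

  -- Moving the shift to any run whose undecorated part is a single letter keeps all schedule numbers 1:
  -- the runs strictly between the two shifts change between OneBelow and OneAbove, which are
  -- equivalent for consecutive short runs.
  schedOne-moveShift : ∀ t → t < length rs → length (undec rs t) ≡ 1 → SchedOne t rs
  schedOne-moveShift t t<l ρ̃ₜ≡1 i i<l = decoratedOne i i<l , below′ , atShift′ , above′ i i<l
    where
    undec≢[]-from-t : ∀ k → k < length rs → t ≤ k → undec rs k ≢ []
    undec≢[]-from-t (suc k) k<l _ = undec-suc≢[] k k<l
    undec≢[]-from-t zero    _   t≤0 rewrite n≤0⇒n≡0 t≤0 = length≡1⇒nonempty ρ̃ₜ≡1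

    below′ : i < t → All (OneBelow (undec rs i) (undec rs (suc i))) (undec rs i)
    below′ i<t with i <? s
    ... | yes i<s = below i i<l i<s
    ... | no  i≮s = Equivalence.from (oneBelow⇔oneAbove (short i i<l (undec≢[] i i<l s≤i))
                                                         (short (suc i) i+1<l (undec-suc≢[] i i+1<l)))
                                     (above (suc i) i+1<l (s≤s s≤i))
      where
      s≤i : s ≤ i
      s≤i = ≮⇒≥ i≮s
      i+1<l : suc i < length rs
      i+1<l = <-≤-trans (s≤s i<t) t<l

    atShift′ : i ≡ t → All (OneAtShift (undec rs i)) (undec rs i)
    atShift′ refl = singleton-oneAtShift (undec rs i) ρ̃ₜ≡1

    above′ : ∀ j → j < length rs → t < j → All (OneAbove (undecBefore [] rs j) (undec rs j)) (undec rs j)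
    above′ j j<l t<j with s <? j
    above′ j       j<l t<j         | yes s<j = above j j<l s<j
    above′ (suc k) j<l (s≤s t≤k)   | no  s≮j =
      Equivalence.to (oneBelow⇔oneAbove (short k k<l (undec≢[]-from-t k k<l t≤k))
                                        (short (suc k) j<l (undec-suc≢[] k j<l)))
                     (below k k<l (≤-trans (n<1+n k) (≮⇒≥ s≮j)))
      where
      k<l : k < length rs
      k<l = <-trans (n<1+n k) j<l

undec-nonempty⇒index< : ∀ rs i → undec rs i ≢ [] → i < length rs
undec-nonempty⇒index< rs i ρ̃≢[] with i <? length rs
... | yes i<l = i<l
... | no  i≮l = contradiction (cong tildeRun (run-beyond rs i (≮⇒≥ i≮l))) ρ̃≢[]

schedWord-moveShift : ∀ σ → σ ≢ [] → ∀ t t′ → schedWord σ (+ t) ≡ replicate (length σ) 1 →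
  (schedWord σ (+ t′) ≡ replicate (length σ) 1) ⇔ (length (undec (runs σ) t′) ≡ 1)
schedWord-moveShift σ σ≢[] t t′ onesₜ = mk⇔ to from
  where
  open SchedOneProperties (runs σ) (wellFormedRuns σ)
  to : schedWord σ (+ t′) ≡ replicate (length σ) 1 → length (undec (runs σ) t′) ≡ 1
  to onesₜ′ = let (t′<l , oneₜ′) = Equivalence.to (schedWord≡ones⇔ σ t′ σ≢[]) onesₜ′
              in length-undec-shift≡1 oneₜ′ t′<l
  from : length (undec (runs σ) t′) ≡ 1 → schedWord σ (+ t′) ≡ replicate (length σ) 1
  from ρ̃≡1 = Equivalence.from (schedWord≡ones⇔ σ t′ σ≢[]) (t′<l , schedOne-moveShift oneₜ t′ t′<l ρ̃≡1)
    where
    oneₜ : SchedOne t (runs σ)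
    oneₜ = proj₂ (Equivalence.to (schedWord≡ones⇔ σ t σ≢[]) onesₜ)
    t′<l : t′ < length (runs σ)
    t′<l = undec-nonempty⇒index< (runs σ) t′ (length≡1⇒nonempty ρ̃≡1)

-- Heights along a path

<⇒+1≤ : ∀ {a b} → a ℤ.< b → a ℤ.+ + 1 ℤ.≤ b
<⇒+1≤ {a} a<b = subst (ℤ._≤ _) (ℤₚ.+-comm (+ 1) a) (ℤₚ.i<j⇒suc[i]≤j a<b)

≢+suc : ∀ a t → a ≢ a ℤ.+ + suc t
≢+suc a t a≡a+1+t = 0≢1+n (ℤₚ.+-injective (∙-cancelˡ a (+ 0) (+ suc t) (trans (ℤₚ.+-identityʳ a) a≡a+1+t)))

<+1 : ∀ a → a ℤ.< a ℤ.+ + 1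
<+1 a = ℤₚ.suc[i]≤j⇒i<j (ℤₚ.≤-reflexive (ℤₚ.+-comm (+ 1) a))

+1-1 : ∀ a → (a ℤ.+ + 1) ℤ.- + 1 ≡ a
+1-1 = solve-∀

endHeight : ℤ → Path → ℤ
endHeight d []              = d
endHeight d (east ∷ p)      = endHeight (d ℤ.- + 1) p
endHeight d (north _ _ ∷ p) = endHeight (d ℤ.+ + 1) p

vertsFrom-++ : ∀ d p q → vertsFrom d (p ++ q) ≡ vertsFrom d p ++ vertsFrom (endHeight d p) q
vertsFrom-++ d []              q = refl
vertsFrom-++ d (east ∷ p)      q = vertsFrom-++ (d ℤ.- + 1) p q
vertsFrom-++ d (north w b ∷ p) q = cong (vstep d w b ∷_) (vertsFrom-++ (d ℤ.+ + 1) p q)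

endHeight-++ : ∀ d p q → endHeight d (p ++ q) ≡ endHeight (endHeight d p) q
endHeight-++ d []              q = refl
endHeight-++ d (east ∷ p)      q = endHeight-++ (d ℤ.- + 1) p q
endHeight-++ d (north _ _ ∷ p) q = endHeight-++ (d ℤ.+ + 1) p q

raise : ℤ → VStep → VStep
raise c v = vstep (area v ℤ.+ c) (label v) (dec v)

private
  +1-commute : ∀ d c → (d ℤ.+ c) ℤ.+ + 1 ≡ (d ℤ.+ + 1) ℤ.+ c
  +1-commute = solve-∀
  -1-commute : ∀ d c → (d ℤ.+ c) ℤ.- + 1 ≡ (d ℤ.- + 1) ℤ.+ c
  -1-commute = solve-∀

vertsFrom-raise : ∀ d c p → vertsFrom (d ℤ.+ c) p ≡ map (raise c) (vertsFrom d p)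
vertsFrom-raise d c []              = refl
vertsFrom-raise d c (east ∷ p)      =
  trans (cong (λ e → vertsFrom e p) (-1-commute d c)) (vertsFrom-raise (d ℤ.- + 1) c p)
vertsFrom-raise d c (north w b ∷ p) =
  cong (vstep (d ℤ.+ c) w b ∷_)
       (trans (cong (λ e → vertsFrom e p) (+1-commute d c)) (vertsFrom-raise (d ℤ.+ + 1) c p))

endHeight-raise : ∀ d c p → endHeight (d ℤ.+ c) p ≡ endHeight d p ℤ.+ c
endHeight-raise d c []              = refl
endHeight-raise d c (east ∷ p)      =
  trans (cong (λ e → endHeight e p) (-1-commute d c)) (endHeight-raise (d ℤ.- + 1) c p)
endHeight-raise d c (north _ _ ∷ p) =
  trans (cong (λ e → endHeight e p) (+1-commute d c)) (endHeight-raise (d ℤ.+ + 1) c p)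

-- Stated without subtraction: endHeight d p = d + #north − #east.
endHeight-balance : ∀ d p → endHeight d p ℤ.+ + numEast p ≡ d ℤ.+ + length (vertsFrom d p)
endHeight-balance d []              = refl
endHeight-balance d (east ∷ p)      = begin
  h ℤ.+ + suc (numEast p)          ≡⟨ cong (ℤ._+_ h) (ℤₚ.pos-+ 1 (numEast p)) ⟩
  h ℤ.+ (+ 1 ℤ.+ + numEast p)      ≡⟨ shuffle h (+ numEast p) ⟩
  (h ℤ.+ + numEast p) ℤ.+ + 1      ≡⟨ cong (ℤ._+ + 1) (endHeight-balance (d ℤ.- + 1) p) ⟩
  ((d ℤ.- + 1) ℤ.+ + N) ℤ.+ + 1    ≡⟨ cancel d (+ N) ⟩
  d ℤ.+ + N                        ∎
  where
  open ≡-Reasoning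
  h : ℤ
  h = endHeight (d ℤ.- + 1) p
  N : ℕ
  N = length (vertsFrom (d ℤ.- + 1) p)
  shuffle : ∀ x y → x ℤ.+ (+ 1 ℤ.+ y) ≡ (x ℤ.+ y) ℤ.+ + 1
  shuffle = solve-∀
  cancel : ∀ x y → ((x ℤ.- + 1) ℤ.+ y) ℤ.+ + 1 ≡ x ℤ.+ y
  cancel = solve-∀
endHeight-balance d (north _ _ ∷ p) = begin
  endHeight (d ℤ.+ + 1) p ℤ.+ + numEast p  ≡⟨ endHeight-balance (d ℤ.+ + 1) p ⟩
  (d ℤ.+ + 1) ℤ.+ + N                      ≡⟨ shuffle d (+ N) ⟩
  d ℤ.+ (+ 1 ℤ.+ + N)                      ≡⟨ cong (ℤ._+_ d) (ℤₚ.pos-+ 1 N) ⟨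
  d ℤ.+ + suc N                            ∎
  where
  open ≡-Reasoning
  N : ℕ
  N = length (vertsFrom (d ℤ.+ + 1) p)
  shuffle : ∀ x y → (x ℤ.+ + 1) ℤ.+ y ≡ x ℤ.+ (+ 1 ℤ.+ y)
  shuffle = solve-∀

squarePath-endHeight : ∀ {n} p → numNorth p ≡ n → numEast p ≡ n → endHeight (+ 0) p ≡ + 0
squarePath-endHeight {n} p #north #east = ∙-cancelʳ (+ n) _ _ (begin
  endHeight (+ 0) p ℤ.+ + n           ≡⟨ cong (λ k → endHeight (+ 0) p ℤ.+ + k) #east ⟨
  endHeight (+ 0) p ℤ.+ + numEast p   ≡⟨ endHeight-balance (+ 0) p ⟩
  + 0 ℤ.+ + numNorth p                ≡⟨ cong (λ k → + 0 ℤ.+ + k) #north ⟩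
  + 0 ℤ.+ + n                          ∎)
  where open ≡-Reasoning

-- The diagonal word and the cutting cycle

Distinct : List VStep → Set
Distinct = AllPairs (λ u v → label u ≢ label v)

distinct-resp-↭ : ∀ {us vs} → us ↭ vs → Distinct us → Distinct vs
distinct-resp-↭ = AllPairs-resp-↭ (λ u≢v → u≢v ∘ sym)

data Precedes (u v : VStep) : Set where
  lower    : area u ℤ.< area v → Precedes u v
  sameDiag : area u ≡ area v → label v < label u → Precedes u v

Precedes-trans : ∀ {u v w} → Precedes u v → Precedes v w → Precedes u w
Precedes-trans (lower u<v)          (lower v<w)          = lower (ℤₚ.<-trans u<v v<w)
Precedes-trans (lower u<v)          (sameDiag v≡w _)     = lower (subst (_ ℤ.<_) v≡w u<v)
Precedes-trans (sameDiag u≡v _)     (lower v<w)          = lower (subst (ℤ._< _) (sym u≡v) v<w)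
Precedes-trans (sameDiag u≡v v<u)   (sameDiag v≡w w<v)   = sameDiag (trans u≡v v≡w) (<-trans w<v v<u)

Precedes-asym : ∀ {u v} → Precedes u v → ¬ Precedes v u
Precedes-asym (lower u<v)      (lower v<u)      = ℤₚ.<-asym u<v v<u
Precedes-asym (lower u<v)      (sameDiag v≡u _) = ℤₚ.<-irrefl (sym v≡u) u<v
Precedes-asym (sameDiag u≡v _) (lower v<u)      = ℤₚ.<-irrefl (sym u≡v) v<u
Precedes-asym (sameDiag _ v<u) (sameDiag _ u<v) = <-asym v<u u<v

Precedes-raise : ∀ c {u v} → Precedes u v → Precedes (raise c u) (raise c v)
Precedes-raise c (lower u<v)        = lower (ℤₚ.+-monoˡ-< c u<v)
Precedes-raise c (sameDiag u≡v v<u) = sameDiag (cong (ℤ._+ c) u≡v) v<u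

before⇒Precedes : ∀ u v → before u v ≡ true → Precedes u v
before⇒Precedes u v before with area u ℤ.<? area v | area u ℤ.≟ area v
... | yes u<v | _       = lower u<v
... | no  _   | yes u≡v = sameDiag u≡v (<ᵇ≡true⇒< before)
... | no  _   | no  _   = contradiction before λ ()

¬before⇒Precedes : ∀ u v → label u ≢ label v → before u v ≡ false → Precedes v u
¬before⇒Precedes u v u≢v ¬before with area u ℤ.<? area v | area u ℤ.≟ area v
... | yes _   | _       = contradiction ¬before λ ()
... | no  _   | yes u≡v = sameDiag (sym u≡v) (≤∧≢⇒< (≮⇒≥ (<ᵇ≡false⇒≮ ¬before)) u≢v)
... | no  u≮v | no  u≢v = lower (ℤₚ.≤∧≢⇒< (ℤₚ.≮⇒≥ u≮v) (u≢v ∘ sym))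

diagonalSort : List VStep → List VStep
diagonalSort = foldr insertDW []

insertDW-↭ : ∀ v us → insertDW v us ↭ v ∷ us
insertDW-↭ v []       = ↭-refl
insertDW-↭ v (u ∷ us) with before v u
... | true  = ↭-refl
... | false = ↭-trans (↭-prep u (insertDW-↭ v us)) (↭-swap u v ↭-refl)

diagonalSort-↭ : ∀ vs → diagonalSort vs ↭ vs
diagonalSort-↭ []       = ↭-refl
diagonalSort-↭ (v ∷ vs) = ↭-trans (insertDW-↭ v (diagonalSort vs)) (↭-prep v (diagonalSort-↭ vs))

insertDW-sorted : ∀ v us → AllPairs Precedes us → All (λ u → label v ≢ label u) us →
                  AllPairs Precedes (insertDW v us)
insertDW-sorted v []       _            _            = [] ∷ []
insertDW-sorted v (u ∷ us) (u< ∷ sorted) (v≢u ∷ v≢us) with before v u in v≺u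
... | true  = (v<u ∷ All.map (Precedes-trans v<u) u<) ∷ u< ∷ sorted
  where
  v<u : Precedes v u
  v<u = before⇒Precedes v u v≺u
... | false = ↭.All-resp-↭ (↭-sym (insertDW-↭ v us)) (¬before⇒Precedes v u v≢u v≺u ∷ u<)
            ∷ insertDW-sorted v us sorted v≢us

diagonalSort-sorted : ∀ vs → Distinct vs → AllPairs Precedes (diagonalSort vs)
diagonalSort-sorted []       _              = []
diagonalSort-sorted (v ∷ vs) (v≢vs ∷ dist) =
  insertDW-sorted v (diagonalSort vs) (diagonalSort-sorted vs dist)
                  (↭.All-resp-↭ (↭-sym (diagonalSort-↭ vs)) v≢vs)

-- Precedes is a strict order, so a list has at most one ordering sorted by it.
sorted-↭-unique : ∀ {us vs} → AllPairs Precedes us → AllPairs Precedes vs → us ↭ vs → us ≡ vs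
sorted-↭-unique {[]}     {[]}     _ _ _ = refl
sorted-↭-unique {[]}     {_ ∷ _}  _ _ p = contradiction (↭.↭-length p) λ ()
sorted-↭-unique {_ ∷ _}  {[]}     _ _ p = contradiction (↭.↭-length p) λ ()
sorted-↭-unique {u ∷ us} {v ∷ vs} (u< ∷ su) (v< ∷ sv) p
  with ↭.∈-resp-↭ p (here refl) | ↭.∈-resp-↭ (↭-sym p) (here refl)
... | here refl | _         = cong (u ∷_) (sorted-↭-unique su sv (↭.drop-∷ p))
... | there _   | here refl = cong (u ∷_) (sorted-↭-unique su sv (↭.drop-∷ p))
... | there u∈vs | there v∈us = contradiction (All.lookup u< v∈us) (Precedes-asym (All.lookup v< u∈vs))

diagonalSort-++-comm : ∀ us vs → Distinct (us ++ vs) → diagonalSort (us ++ vs) ≡ diagonalSort (vs ++ us)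
diagonalSort-++-comm us vs dist = sorted-↭-unique
  (diagonalSort-sorted _ dist)
  (diagonalSort-sorted _ (distinct-resp-↭ (↭.++-comm us vs) dist))
  (↭-trans (diagonalSort-↭ _) (↭-trans (↭.++-comm us vs) (↭-sym (diagonalSort-↭ _))))

diagonalSort-raise : ∀ c vs → Distinct vs → diagonalSort (map (raise c) vs) ≡ map (raise c) (diagonalSort vs)
diagonalSort-raise c vs dist = sorted-↭-unique
  (diagonalSort-sorted _ (AllPairs.map⁺ dist))
  (AllPairs.map⁺ (AllPairs.map (Precedes-raise c) (diagonalSort-sorted vs dist)))
  (↭-trans (diagonalSort-↭ _) (↭.map⁺ (raise c) (↭-sym (diagonalSort-↭ vs))))

letter : VStep → Letter
letter v = label v , dec v

diagonalWord : List VStep → List Letter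
diagonalWord vs = map letter (diagonalSort vs)

diagonalWord-raise : ∀ c vs → Distinct vs → diagonalWord (map (raise c) vs) ≡ diagonalWord vs
diagonalWord-raise c vs dist = begin
  map letter (diagonalSort (map (raise c) vs))   ≡⟨ cong (map letter) (diagonalSort-raise c vs dist) ⟩
  map letter (map (raise c) (diagonalSort vs))   ≡⟨ map-∘ (diagonalSort vs) ⟨
  map letter (diagonalSort vs)                   ∎
  where open ≡-Reasoning

module Rotation (p q : Path) (closed : endHeight (+ 0) (p ++ q) ≡ + 0) where

  private
    h : ℤ
    h = endHeight (+ 0) p
    A B : List VStep
    A = vsteps p
    B = vertsFrom h q

    endHeight-q : endHeight (+ 0) q ≡ - h
    endHeight-q = begin
      endHeight (+ 0) q              ≡⟨ cong (λ d → endHeight d q) (ℤₚ.+-inverseʳ h) ⟨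
      endHeight (h ℤ.+ - h) q        ≡⟨ endHeight-raise h (- h) q ⟩
      endHeight h q ℤ.+ - h          ≡⟨ cong (ℤ._+ - h) (trans (sym (endHeight-++ (+ 0) p q)) closed) ⟩
      + 0 ℤ.+ - h                    ≡⟨ ℤₚ.+-identityˡ (- h) ⟩
      - h                            ∎
      where open ≡-Reasoning

  vsteps-rotate : vsteps (q ++ p) ≡ map (raise (- h)) (B ++ A)
  vsteps-rotate = begin
    vsteps (q ++ p)                                          ≡⟨ vertsFrom-++ (+ 0) q p ⟩
    vertsFrom (+ 0) q ++ vertsFrom (endHeight (+ 0) q) p    ≡⟨ cong₂ _++_ startB startA ⟩
    map (raise (- h)) B ++ map (raise (- h)) A              ≡⟨ map-++ (raise (- h)) B A ⟨
    map (raise (- h)) (B ++ A)                               ∎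
    where
    open ≡-Reasoning
    startB : vertsFrom (+ 0) q ≡ map (raise (- h)) B
    startB = trans (cong (λ d → vertsFrom d q) (sym (ℤₚ.+-inverseʳ h))) (vertsFrom-raise h (- h) q)
    startA : vertsFrom (endHeight (+ 0) q) p ≡ map (raise (- h)) A
    startA = trans (cong (λ d → vertsFrom d p) (trans endHeight-q (sym (ℤₚ.+-identityˡ (- h)))))
                   (vertsFrom-raise (+ 0) (- h) p)

  module _ (dist : Distinct (vsteps (p ++ q))) where

    private
      distAB : Distinct (A ++ B)
      distAB = subst Distinct (vertsFrom-++ (+ 0) p q) dist

      distBA : Distinct (B ++ A)
      distBA = distinct-resp-↭ (↭.++-comm A B) distAB

    distinct-rotate : Distinct (vsteps (q ++ p))
    distinct-rotate = subst Distinct (sym vsteps-rotate) (AllPairs.map⁺ distBA)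

    dw-rotate : dw (q ++ p) ≡ dw (p ++ q)
    dw-rotate = begin
      diagonalWord (vsteps (q ++ p))              ≡⟨ cong diagonalWord vsteps-rotate ⟩
      diagonalWord (map (raise (- h)) (B ++ A))   ≡⟨ diagonalWord-raise (- h) (B ++ A) distBA ⟩
      diagonalWord (B ++ A)                       ≡⟨ cong (map letter) (diagonalSort-++-comm A B distAB) ⟨
      diagonalWord (A ++ B)                       ≡⟨ cong diagonalWord (vertsFrom-++ (+ 0) p q) ⟨
      diagonalWord (vsteps (p ++ q))              ∎
      where open ≡-Reasoning

splitAfterEast-++ : ∀ i p → proj₁ (splitAfterEast i p) ++ proj₂ (splitAfterEast i p) ≡ p
splitAfterEast-++ zero    p               = refl
splitAfterEast-++ (suc i) []              = refl
splitAfterEast-++ (suc i) (east ∷ p)      = cong (east ∷_) (splitAfterEast-++ i p)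
splitAfterEast-++ (suc i) (north w b ∷ p) = cong (north w b ∷_) (splitAfterEast-++ (suc i) p)

cuttingCycle-rotation : ∀ i p → endHeight (+ 0) p ≡ + 0 → Distinct (vsteps p) →
                        dw (ψ i p) ≡ dw p × Distinct (vsteps (ψ i p))
cuttingCycle-rotation i p closed dist with splitAfterEast i p | splitAfterEast-++ i p
... | p₁ , p₂ | refl = Rotation.dw-rotate p₁ p₂ closed dist , Rotation.distinct-rotate p₁ p₂ closed dist

standard⇒distinct : ∀ {n} p → labels p ↭ map suc (upTo n) → Distinct (vsteps p)
standard⇒distinct {n} p labels↭ =
  AllPairs.map⁻ (AllPairs-resp-↭ (λ x≢y → x≢y ∘ sym) (↭-sym labels↭) (Unique-map⁺ suc-injective (upTo⁺ n)))

length-dw : ∀ p → length (dw p) ≡ numNorth p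
length-dw p = trans (length-map letter (diagonalSort (vsteps p))) (↭.↭-length (diagonalSort-↭ (vsteps p)))

-- The runs of the diagonal word are its diagonals

ColumnIncreasing-tail : ∀ s p → ColumnIncreasing (s ∷ p) → ColumnIncreasing p
ColumnIncreasing-tail east              p                  ci       = ci
ColumnIncreasing-tail (north _ _)       []                 _        = tt
ColumnIncreasing-tail (north _ _)       (east ∷ p)         ci       = ci
ColumnIncreasing-tail (north _ _)       (north _ _ ∷ p)    (_ , ci) = ci

ColumnIncreasing-++ˡ : ∀ p q → ColumnIncreasing (p ++ q) → ColumnIncreasing p
ColumnIncreasing-++ˡ []                       q _        = tt
ColumnIncreasing-++ˡ (east ∷ p)               q ci       = ColumnIncreasing-++ˡ p q ci
ColumnIncreasing-++ˡ (north _ _ ∷ [])         q _        = tt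
ColumnIncreasing-++ˡ (north _ _ ∷ east ∷ p)   q ci       = ColumnIncreasing-++ˡ (east ∷ p) q ci
ColumnIncreasing-++ˡ (north _ _ ∷ north w b ∷ p) q (w<w′ , ci) =
  w<w′ , ColumnIncreasing-++ˡ (north w b ∷ p) q ci

record AscendingPairAt (vs : List VStep) (j : ℤ) : Set where
  constructor ascendingPair
  field
    {low high} : VStep
    low∈       : low ∈ vs
    high∈      : high ∈ vs
    low-area   : area low ≡ j
    high-area  : area high ≡ j ℤ.+ + 1
    ascending  : label low < label high

ascendingPair-∷ : ∀ {v vs j} → AscendingPairAt vs j → AscendingPairAt (v ∷ vs) j
ascendingPair-∷ (ascendingPair low∈ high∈ low-area high-area asc) =
  ascendingPair (there low∈) (there high∈) low-area high-area asc

ascendingPair-here : ∀ d w b w′ b′ p → ColumnIncreasing (north w b ∷ north w′ b′ ∷ p) →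
                     AscendingPairAt (vertsFrom d (north w b ∷ north w′ b′ ∷ p)) d
ascendingPair-here d w b w′ b′ p (w<w′ , _) = ascendingPair (here refl) (there (here refl)) refl refl w<w′

-- Starting at height d ≤ j, a path reaching a vertical step above j leaves diagonal j upwards
-- through two consecutive north steps, whose labels increase by column-increasingness.
ascendingPair-below : ∀ d p j → d ℤ.≤ j → ColumnIncreasing p → Any (λ w → j ℤ.< area w) (vertsFrom d p) →
                      AscendingPairAt (vertsFrom d p) j
ascendingPair-below d []         j _   _  ()
ascendingPair-below d (east ∷ p) j d≤j ci above =
  ascendingPair-below (d ℤ.- + 1) p j (ℤₚ.≤-trans (ℤₚ.i-j≤i d (+ 1)) d≤j) ci above
ascendingPair-below d (north w b ∷ p) j d≤j ci above with ℤₚ.<-cmp d j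
... | tri> _ _ j<d = contradiction d≤j (ℤₚ.<⇒≱ j<d)
... | tri< d<j _ _ = ascendingPair-∷ (ascendingPair-below (d ℤ.+ + 1) p j (<⇒+1≤ d<j)
                       (ColumnIncreasing-tail (north w b) p ci) (Any.tail (ℤₚ.<-asym d<j) above))
ascendingPair-below d (north w b ∷ []) j _ _ above | tri≈ _ refl _ =
  contradiction (Any.tail (ℤₚ.<-irrefl refl) above) λ ()
ascendingPair-below d (north w b ∷ north w′ b′ ∷ p) j _ ci _ | tri≈ _ refl _ =
  ascendingPair-here d w b w′ b′ p ci
ascendingPair-below d (north w b ∷ east ∷ p) j _ ci above | tri≈ _ refl _ =
  ascendingPair-∷ (subst (AscendingPairAt _) (+1-1 d)
    (ascendingPair-below ((d ℤ.+ + 1) ℤ.- + 1) p _ ℤₚ.≤-refl ci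
      (Any.map (ℤₚ.≤-<-trans (ℤₚ.≤-reflexive (+1-1 d))) (Any.tail (ℤₚ.<-irrefl refl) above))))

-- The same climb, for a path that must end above j + 1.
ascendingPair-toEnd : ∀ d p j → ColumnIncreasing p → d ℤ.≤ j ⊎ Any (λ w → area w ≡ j) (vertsFrom d p) →
                      j ℤ.+ + 1 ℤ.< endHeight d p → AscendingPairAt (vertsFrom d p) j
ascendingPair-toEnd d [] j _ (inj₁ d≤j) j+1<d = contradiction d≤j (ℤₚ.<⇒≱ (ℤₚ.<-trans (<+1 j) j+1<d))
ascendingPair-toEnd d (east ∷ p) j ci (inj₁ d≤j) end =
  ascendingPair-toEnd (d ℤ.- + 1) p j ci (inj₁ (ℤₚ.≤-trans (ℤₚ.i-j≤i d (+ 1)) d≤j)) end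
ascendingPair-toEnd d (east ∷ p) j ci (inj₂ onj) end = ascendingPair-toEnd (d ℤ.- + 1) p j ci (inj₂ onj) end
ascendingPair-toEnd d (north w b ∷ p) j ci start end with ℤₚ.<-cmp d j
... | tri< d<j _ _ = ascendingPair-∷ (ascendingPair-toEnd (d ℤ.+ + 1) p j
                       (ColumnIncreasing-tail (north w b) p ci) (inj₁ (<⇒+1≤ d<j)) end)
ascendingPair-toEnd d (north w b ∷ p) j ci (inj₁ d≤j) end | tri> _ _ j<d = contradiction d≤j (ℤₚ.<⇒≱ j<d)
ascendingPair-toEnd d (north w b ∷ p) j ci (inj₂ onj) end | tri> _ _ j<d =
  ascendingPair-∷ (ascendingPair-toEnd (d ℤ.+ + 1) p j (ColumnIncreasing-tail (north w b) p ci)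
                     (inj₂ (Any.tail (λ d≡j → ℤₚ.<-irrefl (sym d≡j) j<d) onj)) end)
ascendingPair-toEnd d (north w b ∷ []) j _ _ end | tri≈ _ refl _ = contradiction end (ℤₚ.<-irrefl refl)
ascendingPair-toEnd d (north w b ∷ north w′ b′ ∷ p) j ci _ _ | tri≈ _ refl _ =
  ascendingPair-here d w b w′ b′ p ci
ascendingPair-toEnd d (north w b ∷ east ∷ p) j ci _ end | tri≈ _ refl _ =
  ascendingPair-∷ (subst (AscendingPairAt _) (+1-1 d)
    (ascendingPair-toEnd ((d ℤ.+ + 1) ℤ.- + 1) p _ ci (inj₁ ℤₚ.≤-refl)
      (subst (λ e → e ℤ.+ + 1 ℤ.< endHeight ((d ℤ.+ + 1) ℤ.- + 1) p) (sym (+1-1 d)) end)))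

NoGaps : List VStep → Set
NoGaps vs = ∀ {u w} → u ∈ vs → w ∈ vs → area u ℤ.< area w → AscendingPairAt vs (area u)

-- For a diagonal j ≥ 0 the path climbs from its start at height 0; for j < 0 it has to climb back
-- from a step on diagonal j to height 1, where its final east step starts.
squarePath-noGaps : ∀ q → ColumnIncreasing (q ++ [ east ]) → endHeight (+ 0) (q ++ [ east ]) ≡ + 0 →
                    NoGaps (vsteps (q ++ [ east ]))
squarePath-noGaps q ci closed {u} u∈ w∈ u<w with + 0 ℤ.≤? area u
... | yes 0≤u = ascendingPair-below (+ 0) (q ++ [ east ]) (area u) 0≤u ci (Any.map (λ { refl → u<w }) w∈)
... | no  u≱0 = subst (λ vs → AscendingPairAt vs (area u)) (sym vsteps-q)
                  (ascendingPair-toEnd (+ 0) q (area u) (ColumnIncreasing-++ˡ q _ ci)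
                    (inj₂ (Any.map (λ { refl → refl }) (subst (u ∈_) vsteps-q u∈))) end)
  where
  vsteps-q : vsteps (q ++ [ east ]) ≡ vsteps q
  vsteps-q = trans (vertsFrom-++ (+ 0) q [ east ]) (++-identityʳ _)
  endHeight-q : endHeight (+ 0) q ≡ + 1
  endHeight-q = begin
    endHeight (+ 0) q                     ≡⟨ -1+1 (endHeight (+ 0) q) ⟩
    (endHeight (+ 0) q ℤ.- + 1) ℤ.+ + 1   ≡⟨ cong (ℤ._+ + 1) (trans (sym (endHeight-++ (+ 0) q _)) closed) ⟩
    + 1                                   ∎
    where
    open ≡-Reasoning
    -1+1 : ∀ x → x ≡ (x ℤ.- + 1) ℤ.+ + 1
    -1+1 = solve-∀
  end : area u ℤ.+ + 1 ℤ.< endHeight (+ 0) q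
  end = subst (area u ℤ.+ + 1 ℤ.<_) (sym endHeight-q) (ℤₚ.+-monoˡ-< (+ 1) (ℤₚ.≰⇒> u≱0))

Precedes⇒area≤ : ∀ {u v} → Precedes u v → area u ℤ.≤ area v
Precedes⇒area≤ (lower u<v)      = ℤₚ.<⇒≤ u<v
Precedes⇒area≤ (sameDiag u≡v _) = ℤₚ.≤-reflexive u≡v

_≼_ : VStep → VStep → Set
u ≼ v = u ≡ v ⊎ Precedes u v

≼⇒area≤ : ∀ {u v} → u ≼ v → area u ℤ.≤ area v
≼⇒area≤ (inj₁ refl) = ℤₚ.≤-refl
≼⇒area≤ (inj₂ u≺v)  = Precedes⇒area≤ u≺v

-- If v directly follows u in the diagonal word of vs and lies on a higher diagonal, then an ascending
-- pair p, q at area u squeezes it: label u ≤ label p < label q ≤ label v.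
adjacent-jump : ∀ {vs u v} → (∀ {x} → x ∈ vs → x ≼ u ⊎ v ≼ x) → area u ℤ.< area v →
                AscendingPairAt vs (area u) → area v ≡ area u ℤ.+ + 1 × label u < label v
adjacent-jump {vs} {u} {v} placed u<v (ascendingPair {p} {q} p∈ q∈ p-area q-area p<q) =
  v-area , ≤-<-trans u≤p (<-≤-trans p<q q≤v)
  where
  v≼q : v ≼ q
  v≼q with placed q∈
  ... | inj₁ q≼u = contradiction (subst (ℤ._≤ area u) q-area (≼⇒area≤ q≼u)) (ℤₚ.<⇒≱ (<+1 (area u)))
  ... | inj₂ v≼q = v≼q
  v-area : area v ≡ area u ℤ.+ + 1
  v-area = ℤₚ.≤-antisym (subst (area v ℤ.≤_) q-area (≼⇒area≤ v≼q)) (<⇒+1≤ u<v)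
  q≤v : label q ≤ label v
  q≤v with v≼q
  ... | inj₁ refl             = ≤-refl
  ... | inj₂ (lower v<q)      = contradiction (trans v-area (sym q-area)) (ℤₚ.<⇒≢ v<q)
  ... | inj₂ (sameDiag _ q<v) = <⇒≤ q<v
  u≤p : label u ≤ label p
  u≤p with placed p∈
  ... | inj₁ (inj₁ refl)              = ≤-refl
  ... | inj₁ (inj₂ (lower p<u))       = contradiction p-area (ℤₚ.<⇒≢ p<u)
  ... | inj₁ (inj₂ (sameDiag _ u<p))  = <⇒≤ u<p
  ... | inj₂ v≼p = contradiction (subst (area v ℤ.≤_) p-area (≼⇒area≤ v≼p)) (ℤₚ.<⇒≱ u<v)

DiagonalJump : VStep → VStep → Set
DiagonalJump u v = area u ≡ area v ⊎ (area v ≡ area u ℤ.+ + 1 × label u < label v)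

-- ws is a sorted suffix of the diagonal word of vs: everything else in vs precedes it.
sorted-jumps : ∀ {vs} ws → AllPairs Precedes ws → (∀ {x} → x ∈ ws → x ∈ vs) →
               (∀ {x} → x ∈ vs → x ∈ ws ⊎ All (Precedes x) ws) → NoGaps vs → Linked DiagonalJump ws
sorted-jumps []           _                      _   _      _      = []
sorted-jumps (_ ∷ [])     _                      _   _      _      = [-]
sorted-jumps {vs} (u ∷ v ∷ ws) ((u≺v ∷ u≺ws) ∷ sorted@(v≺ws ∷ _)) sub placed noGaps =
  jump u≺v ∷ sorted-jumps (v ∷ ws) sorted (sub ∘ there) placed′ noGaps
  where
  placedAround : ∀ {x} → x ∈ vs → x ≼ u ⊎ v ≼ x
  placedAround x∈ with placed x∈
  ... | inj₁ (here x≡u)                 = inj₁ (inj₁ x≡u)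
  ... | inj₁ (there (here x≡v))         = inj₂ (inj₁ (sym x≡v))
  ... | inj₁ (there (there x∈ws))       = inj₂ (inj₂ (All.lookup v≺ws x∈ws))
  ... | inj₂ (x≺u ∷ _)                  = inj₁ (inj₂ x≺u)
  jump : Precedes u v → DiagonalJump u v
  jump (sameDiag u≡v _) = inj₁ u≡v
  jump (lower u<v)      =
    inj₂ (adjacent-jump placedAround u<v (noGaps (sub (here refl)) (sub (there (here refl))) u<v))
  placed′ : ∀ {x} → x ∈ vs → x ∈ v ∷ ws ⊎ All (Precedes x) (v ∷ ws)
  placed′ x∈ with placed x∈
  ... | inj₁ (here refl)  = inj₂ (u≺v ∷ u≺ws)
  ... | inj₁ (there x∈′)  = inj₁ x∈′
  ... | inj₂ (_ ∷ x≺)     = inj₂ x≺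

countUndecOn : ℤ → List VStep → ℕ
countUndecOn z vs = length (filterᵇ (λ v → does (area v ℤ.≟ z) ∧ not (dec v)) vs)

undecorated : Bool → ℕ
undecorated true  = 0
undecorated false = 1

length-tildeRun-∷ : ∀ c b r → length (tildeRun ((c , b) ∷ r)) ≡ undecorated b + length (tildeRun r)
length-tildeRun-∷ _ true  _ = refl
length-tildeRun-∷ _ false _ = refl

countUndecOn-here : ∀ {z x} vs → area x ≡ z →
                    countUndecOn z (x ∷ vs) ≡ undecorated (dec x) + countUndecOn z vs
countUndecOn-here {z} {x} vs x≡z with area x ℤ.≟ z | dec x
... | yes _   | true  = refl
... | yes _   | false = refl
... | no  x≢z | _     = contradiction x≡z x≢z

countUndecOn-there : ∀ {z x} vs → area x ≢ z → countUndecOn z (x ∷ vs) ≡ countUndecOn z vs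
countUndecOn-there {z} {x} vs x≢z with area x ℤ.≟ z
... | yes x≡z = contradiction x≡z x≢z
... | no  _   = refl

countUndecOn-above : ∀ {z} vs → All (λ v → z ℤ.< area v) vs → countUndecOn z vs ≡ 0
countUndecOn-above []       []           = refl
countUndecOn-above (v ∷ vs) (z<v ∷ z<vs) =
  trans (countUndecOn-there vs (λ v≡z → ℤₚ.<-irrefl (sym v≡z) z<v)) (countUndecOn-above vs z<vs)

addToRuns-head : ∀ y rs → Σ[ r ∈ List Letter ] Σ[ rs′ ∈ List (List Letter) ] addToRuns y rs ≡ (y ∷ r) ∷ rs′
addToRuns-head y []             = [] , [] , refl
addToRuns-head y ([] ∷ rs)      = [] , [] ∷ rs , refl
addToRuns-head y ((z ∷ r) ∷ rs) with proj₁ z <ᵇ proj₁ y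
... | true  = z ∷ r , rs , refl
... | false = [] , (z ∷ r) ∷ rs , refl

module _ (x y : VStep) (rest : List VStep) where

  private
    Counted : List (List Letter) → Set
    Counted rs = ∀ t → length (undec rs t) ≡ countUndecOn (area y ℤ.+ + t) (y ∷ rest)

    Counted′ : List (List Letter) → Set
    Counted′ rs = ∀ t → length (undec rs t) ≡ countUndecOn (area x ℤ.+ + t) (x ∷ y ∷ rest)

    ux : ℕ
    ux = undecorated (dec x)

    counted-here : ∀ {z} → area x ≡ z → countUndecOn z (x ∷ y ∷ rest) ≡ ux + countUndecOn z (y ∷ rest)
    counted-here = countUndecOn-here {x = x} (y ∷ rest)

    counted-above : ∀ t → countUndecOn (area x ℤ.+ + suc t) (x ∷ y ∷ rest)
                          ≡ countUndecOn (area x ℤ.+ + suc t) (y ∷ rest)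
    counted-above t = countUndecOn-there {x = x} (y ∷ rest) (≢+suc (area x) t)

  undec-sameDiagonal : ∀ r rs → area x ≡ area y → label y < label x →
                       Counted ((letter y ∷ r) ∷ rs) → Counted′ (addToRuns (letter x) ((letter y ∷ r) ∷ rs))
  undec-sameDiagonal r rs x≡y y<x counted t rewrite <⇒<ᵇ≡true y<x with t
  ... | zero  = begin
    length (tildeRun (letter x ∷ letter y ∷ r))           ≡⟨ length-tildeRun-∷ _ (dec x) _ ⟩
    ux + length (tildeRun (letter y ∷ r))                 ≡⟨ cong (_+_ ux) (counted 0) ⟩
    ux + countUndecOn (area y ℤ.+ + 0) (y ∷ rest)
                              ≡⟨ cong (λ a → ux + countUndecOn (a ℤ.+ + 0) (y ∷ rest)) x≡y ⟨
    ux + countUndecOn (area x ℤ.+ + 0) (y ∷ rest)         ≡⟨ counted-here (sym (ℤₚ.+-identityʳ _)) ⟨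
    countUndecOn (area x ℤ.+ + 0) (x ∷ y ∷ rest)          ∎
    where open ≡-Reasoning
  ... | suc t′ = begin
    length (undec ((letter y ∷ r) ∷ rs) (suc t′))         ≡⟨ counted (suc t′) ⟩
    countUndecOn (area y ℤ.+ + suc t′) (y ∷ rest)
                              ≡⟨ cong (λ a → countUndecOn (a ℤ.+ + suc t′) (y ∷ rest)) x≡y ⟨
    countUndecOn (area x ℤ.+ + suc t′) (y ∷ rest)         ≡⟨ counted-above t′ ⟨
    countUndecOn (area x ℤ.+ + suc t′) (x ∷ y ∷ rest)     ∎
    where open ≡-Reasoning

  undec-nextDiagonal : ∀ r rs → area y ≡ area x ℤ.+ + 1 → label x < label y →
                       All (λ v → area x ℤ.< area v) (y ∷ rest) →
                       Counted ((letter y ∷ r) ∷ rs) → Counted′ (addToRuns (letter x) ((letter y ∷ r) ∷ rs))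
  undec-nextDiagonal r rs y-area x<y above counted t rewrite ≮⇒<ᵇ≡false (<⇒≯ x<y) with t
  ... | zero  = begin
    length (tildeRun (letter x ∷ []))                     ≡⟨ length-tildeRun-∷ _ (dec x) [] ⟩
    ux + 0                                 ≡⟨ cong (_+_ ux) (countUndecOn-above (y ∷ rest) above′) ⟨
    ux + countUndecOn (area x ℤ.+ + 0) (y ∷ rest)         ≡⟨ counted-here (sym (ℤₚ.+-identityʳ _)) ⟨
    countUndecOn (area x ℤ.+ + 0) (x ∷ y ∷ rest)          ∎
    where
    open ≡-Reasoning
    above′ : All (λ v → area x ℤ.+ + 0 ℤ.< area v) (y ∷ rest)
    above′ = subst (λ a → All (λ v → a ℤ.< area v) (y ∷ rest)) (sym (ℤₚ.+-identityʳ (area x))) above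
  ... | suc t′ = begin
    length (undec ((letter y ∷ r) ∷ rs) t′)               ≡⟨ counted t′ ⟩
    countUndecOn (area y ℤ.+ + t′) (y ∷ rest)             ≡⟨ cong (λ a → countUndecOn a (y ∷ rest)) diagonal ⟩
    countUndecOn (area x ℤ.+ + suc t′) (y ∷ rest)         ≡⟨ counted-above t′ ⟨
    countUndecOn (area x ℤ.+ + suc t′) (x ∷ y ∷ rest)     ∎
    where
    open ≡-Reasoning
    diagonal : area y ℤ.+ + t′ ≡ area x ℤ.+ + suc t′
    diagonal = begin
      area y ℤ.+ + t′               ≡⟨ cong (ℤ._+ + t′) y-area ⟩
      area x ℤ.+ + 1 ℤ.+ + t′       ≡⟨ ℤₚ.+-assoc (area x) (+ 1) (+ t′) ⟩
      area x ℤ.+ (+ 1 ℤ.+ + t′)     ≡⟨ cong (ℤ._+_ (area x)) (ℤₚ.pos-+ 1 t′) ⟨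
      area x ℤ.+ + suc t′           ∎

length-undec-byDiagonal : ∀ x rest → AllPairs Precedes (x ∷ rest) → Linked DiagonalJump (x ∷ rest) → ∀ t →
  length (undec (runs (map letter (x ∷ rest))) t) ≡ countUndecOn (area x ℤ.+ + t) (x ∷ rest)
length-undec-byDiagonal x [] _ _ zero =
  trans (length-tildeRun-∷ _ (dec x) []) (sym (countUndecOn-here {x = x} [] (sym (ℤₚ.+-identityʳ _))))
length-undec-byDiagonal x [] _ _ (suc t) = sym (countUndecOn-there {x = x} [] (≢+suc (area x) t))
length-undec-byDiagonal x (y ∷ rest) ((x≺y ∷ _) ∷ sorted@(y≺rest ∷ _)) (jump ∷ jumps)
  with addToRuns-head (letter y) (runs (map letter rest)) | length-undec-byDiagonal y rest sorted jumps
... | r , rs , runs-y | counted rewrite runs-y with jump | x≺y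
...   | inj₁ x≡y           | lower x<y       = contradiction x≡y (ℤₚ.<⇒≢ x<y)
...   | inj₁ x≡y           | sameDiag _ y<x  = undec-sameDiagonal x y rest r rs x≡y y<x counted
...   | inj₂ (y-area , x<y) | _              = undec-nextDiagonal x y rest r rs y-area x<y
  (x<y′ ∷ All.map (λ y≺v → ℤₚ.<-≤-trans x<y′ (Precedes⇒area≤ y≺v)) y≺rest) counted
  where
  x<y′ : area x ℤ.< area y
  x<y′ = subst (area x ℤ.<_) (sym y-area) (<+1 (area x))

foldr-⊓-lowerBound : ∀ x xs → All (foldr ℤ._⊓_ x xs ℤ.≤_) (x ∷ xs)
foldr-⊓-lowerBound x []       = ℤₚ.≤-refl ∷ []
foldr-⊓-lowerBound x (y ∷ ys) with foldr-⊓-lowerBound x ys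
... | m≤x ∷ m≤ys = ℤₚ.≤-trans y⊓m≤m m≤x ∷ ℤₚ.i⊓j≤i y _ ∷ All.map (ℤₚ.≤-trans y⊓m≤m) m≤ys
  where
  y⊓m≤m : y ℤ.⊓ foldr ℤ._⊓_ x ys ℤ.≤ foldr ℤ._⊓_ x ys
  y⊓m≤m = ℤₚ.i⊓j≤j y (foldr ℤ._⊓_ x ys)

foldr-⊓-∈ : ∀ x xs → foldr ℤ._⊓_ x xs ∈ x ∷ xs
foldr-⊓-∈ x xs with foldr-selective ℤₚ.⊓-sel x xs
... | inj₁ m≡x  = here m≡x
... | inj₂ m∈xs = there m∈xs

minZ-least : ∀ {z} zs → z ∈ zs → (∀ {z′} → z′ ∈ zs → z ℤ.≤ z′) → minZ zs ≡ z
minZ-least []       ()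
minZ-least (x ∷ xs) z∈ least =
  ℤₚ.≤-antisym (All.lookup (foldr-⊓-lowerBound x xs) z∈) (least (foldr-⊓-∈ x xs))

module _ {h rest vs} (sorted : AllPairs Precedes (h ∷ rest)) (h∷rest↭vs : h ∷ rest ↭ vs) where

  sortedHead-≼ : ∀ {v} → v ∈ vs → h ≼ v
  sortedHead-≼ v∈ with ↭.∈-resp-↭ (↭-sym h∷rest↭vs) v∈
  ... | here v≡h   = inj₁ (sym v≡h)
  ... | there v∈rs = inj₂ (All.lookup (AllPairs.head sorted) v∈rs)

  minZ-sorted : minZ (map area vs) ≡ area h
  minZ-sorted = minZ-least (map area vs) (∈-map⁺ area (↭.∈-resp-↭ h∷rest↭vs (here refl))) least
    where
    least : ∀ {z} → z ∈ map area vs → area h ℤ.≤ z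
    least z∈ with ∈-map⁻ area z∈
    ... | v , v∈ , refl = ≼⇒area≤ (sortedHead-≼ v∈)

diagonalWord-shiftRun : ∀ vs → Distinct vs → NoGaps vs → Any (λ v → area v ℤ.≤ + 0) vs →
  Σ[ t ∈ ℕ ] - minZ (map area vs) ≡ + t
           × length (undec (runs (diagonalWord vs)) t) ≡ countUndecOn (+ 0) vs
diagonalWord-shiftRun vs dist noGaps low
  with diagonalSort vs | diagonalSort-↭ vs | diagonalSort-sorted vs dist
... | []       | []↭vs | _      = contradiction (↭.Any-resp-↭ (↭-sym []↭vs) low) λ ()
... | h ∷ rest | perm  | sorted = t , shift≡t , count
  where
  h≤0 : area h ℤ.≤ + 0
  h≤0 with find low
  ... | v , v∈ , v≤0 = ℤₚ.≤-trans (≼⇒area≤ (sortedHead-≼ sorted perm v∈)) v≤0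
  t : ℕ
  t = ℤ.∣ - area h ∣
  t≡ : + t ≡ - area h
  t≡ = ℤₚ.0≤i⇒+∣i∣≡i (ℤₚ.neg-mono-≤ h≤0)
  shift≡t : - minZ (map area vs) ≡ + t
  shift≡t = trans (cong -_ (minZ-sorted sorted perm)) (sym t≡)
  jumps : Linked DiagonalJump (h ∷ rest)
  jumps = sorted-jumps (h ∷ rest) sorted (↭.∈-resp-↭ perm) (λ x∈ → inj₁ (↭.∈-resp-↭ (↭-sym perm) x∈)) noGaps
  count : length (undec (runs (map letter (h ∷ rest))) t) ≡ countUndecOn (+ 0) vs
  count = begin
    length (undec (runs (map letter (h ∷ rest))) t)   ≡⟨ length-undec-byDiagonal h rest sorted jumps t ⟩
    countUndecOn (area h ℤ.+ + t) (h ∷ rest)          ≡⟨ cong (λ z → countUndecOn z (h ∷ rest)) h+t≡0 ⟩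
    countUndecOn (+ 0) (h ∷ rest)                     ≡⟨ ↭.↭-length (↭.filter-↭ _ perm) ⟩
    countUndecOn (+ 0) vs                             ∎
    where
    open ≡-Reasoning
    h+t≡0 : area h ℤ.+ + t ≡ + 0
    h+t≡0 = trans (cong (ℤ._+_ (area h)) t≡) (ℤₚ.+-inverseʳ (area h))

vertsFrom-start : ∀ d p → vertsFrom d p ≢ [] → Any (λ v → area v ℤ.≤ d) (vertsFrom d p)
vertsFrom-start d []              vs≢[] = contradiction refl vs≢[]
vertsFrom-start d (east ∷ p)      vs≢[] =
  Any.map (λ v≤ → ℤₚ.≤-trans v≤ (ℤₚ.i-j≤i d (+ 1))) (vertsFrom-start (d ℤ.- + 1) p vs≢[])
vertsFrom-start d (north _ _ ∷ p) _     = here ℤₚ.≤-refl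

numEast-++-east : ∀ q → numEast (q ++ [ east ]) ≢ 0
numEast-++-east []              ()
numEast-++-east (east ∷ q)      ()
numEast-++-east (north _ _ ∷ q) = numEast-++-east q

squarePath-vsteps≢[] : ∀ {n} p → IsSquarePath n p → vsteps p ≢ []
squarePath-vsteps≢[] _ (#north , #east , q , refl) vs≡[] =
  numEast-++-east q (trans #east (trans (sym #north) (cong length vs≡[])))

squarePath-shiftRun : ∀ {n k} p → LSQ n k p → Distinct (vsteps p) →
  Σ[ t ∈ ℕ ] shift p ≡ + t × length (undec (runs (dw p)) t) ≡ numUndecZeroDiag p
squarePath-shiftRun _ (square@(#north , #east , q , refl) , _ , ci , _ , _) dist =
  diagonalWord-shiftRun (vsteps (q ++ [ east ])) dist
    (squarePath-noGaps q ci (squarePath-endHeight (q ++ [ east ]) #north #east))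
    (vertsFrom-start (+ 0) (q ++ [ east ]) (squarePath-vsteps≢[] _ square))

squarePath-length-dw : ∀ {n} p → IsSquarePath n p → length (dw p) ≡ n
squarePath-length-dw p (#north , _) = trans (length-dw p) #north

squarePath-dw≢[] : ∀ {n} p → IsSquarePath n p → dw p ≢ []
squarePath-dw≢[] p square dw≡[] =
  m<n⇒n≢0 (nonempty⇒1≤length (squarePath-vsteps≢[] p square)) (trans (sym (length-dw p)) (cong length dw≡[]))

mainTheorem6 : (n k : ℕ) (P : Path) → StLSQ n k P → sched P ≡ replicate n 1
    → (Q : Path) → InCC n k P Q
    → (sched Q ≡ replicate n 1) ⇔ (numUndecZeroDiag Q ≡ 1)
mainTheorem6 n k P (lsqP@(squareP@(#north , #east , _) , _) , labels↭) schedP _ ((i , _ , _ , refl) , lsqQ)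
  with standard⇒distinct P labels↭
... | distP with cuttingCycle-rotation i P (squarePath-endHeight P #north #east) distP
... | dwQ≡dwP , distQ with squarePath-shiftRun P lsqP distP | squarePath-shiftRun (ψ i P) lsqQ distQ
... | tP , shiftP , _ | tQ , shiftQ , runQ =
  ⇔.trans (≡⇔≡ (cong₂ schedWord dwQ≡dwP shiftQ) ones-n)
    (⇔.trans (schedWord-moveShift (dw P) (squarePath-dw≢[] P squareP) tP tQ onesP)
             (≡⇔≡ (trans (cong (λ σ → length (undec (runs σ) tQ)) (sym dwQ≡dwP)) runQ) refl))
  where
  ones-n : replicate n 1 ≡ replicate (length (dw P)) 1
  ones-n = cong (λ m → replicate m 1) (sym (squarePath-length-dw P squareP))
  onesP : schedWord (dw P) (+ tP) ≡ replicate (length (dw P)) 1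
  onesP = trans (cong (schedWord (dw P)) (sym shiftP)) (trans schedP ones-n)
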